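{- Let $T_n$ be the space of triagonal fermionic harmonics. (1) If a nonzero polynomial in $T_n\cap\mathbb{Q}[\theta_1,\dots,\theta_n]$ is antisymmetric, then it has degree exactly $n-1$. (2) If a nonzero polynomial in $T_n\cap\mathbb{Q}[\theta_1,\dots,\theta_n,\xi_1,\dots,\xi_n]$ is antisymmetric, then it has degree exactly $n-1$.
   Context: $\mathbb{Q}[\bm\theta_n,\bm\xi_n,\bm\rho_n]$ denotes the exterior algebra over $\mathbb{Q}$ on the $3n$ pairwise anticommuting generators $\theta_i,\xi_i,\rho_i$ ($1\le i\le n$); $\mathbb{Q}[\theta_1,\dots,\theta_n]$ and $\mathbb{Q}[\theta_1,\dots,\theta_n,\xi_1,\dots,\xi_n]$ are the subalgebras generated by the indicated variables. For an anticommuting variable $\theta_j$ (from any of the three sets), the derivative is defined on monomials by $\partial_{\theta_j}\theta_{i_1}\cdots\theta_{i_k}=(-1)^{\ell-1}\theta_{i_1}\cdots\widehat{\theta_{i_\ell}}\cdots\theta_{i_k}$ if $\theta_j$ is the $\ell$-th factor, and $0$ if $\theta_j$ does not occur, extended linearly. The space of triagonal fermionic harmonics is $T_n=\{f : \sum_{i=1}^n\partial_{\theta_i}^h\partial_{\xi_i}^k\partial_{\rho_i}^\ell f=0 \text{ for all } h,k,\ell\in\{0,1\},\ h+k+\ell>0\}$. $\mathfrak{S}_n$ acts diagonally by $\sigma(\theta_i)=\theta_{\sigma(i)}$, $\sigma(\xi_i)=\xi_{\sigma(i)}$, $\sigma(\rho_i)=\rho_{\sigma(i)}$; $p$ is antisymmetric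 if $\sigma(p)=\mathrm{sgn}(\sigma)p$ for all $\sigma\in\mathfrak{S}_n$. -}

module Defs where

open import Data.Bool using (Bool; true; false; if_then_else_; _∧_; _∨_; not)
open import Data.Nat using (ℕ; zero; suc; _+_; _<ᵇ_; _≤_)
open import Data.Fin using (Fin; toℕ) renaming (zero to fzero; suc to fsuc)
open import Data.Fin.Subset using (Subset; ∣_∣) renaming (⊥ to ∅)
open import Data.Fin.Permutation using (Permutation′; _⟨$⟩ʳ_)
open import Data.Vec using (lookup; tabulate; _[_]≔_)
open import Data.Rational using (ℚ; 0ℚ; 1ℚ; _*_; -_) renaming (_+_ to _+ℚ_)
open import Data.Product using (_×_; _,_; ∃)
open import Relation.Binary.PropositionalEquality using (_≡_; _≢_)

-- Elements of the exterior algebra ℚ[θ_n, ξ_n, ρ_n].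
-- Basis monomials: θ_A ξ_B ρ_C  (A, B, C ⊆ {1..n}), where θ_A is the
-- product of θ_a (a ∈ A) in increasing order of a, similarly ξ_B, ρ_C,
-- and the three blocks are written in the order θ, ξ, ρ.

Mono : ℕ → Set
Mono n = Subset n × Subset n × Subset n

Poly : ℕ → Set
Poly n = Mono n → ℚ

deg : ∀ {n} → Mono n → ℕ
deg (A , B , C) = ∣ A ∣ + ∣ B ∣ + ∣ C ∣

sgnPow : ℕ → ℚ
sgnPow zero = 1ℚ
sgnPow (suc k) = - sgnPow k

count : ∀ {n} → (Fin n → Bool) → ℕ
count {zero} f = 0
count {suc n} f = (if f fzero then 1 else 0) + count (λ i → f (fsuc i))

sumℕ : ∀ {n} → (Fin n → ℕ) → ℕ
sumℕ {zero} f = 0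
sumℕ {suc n} f = f fzero + sumℕ (λ i → f (fsuc i))

sumFin : ∀ {n} → (Fin n → ℚ) → ℚ
sumFin {zero} f = 0ℚ
sumFin {suc n} f = f fzero +ℚ sumFin (λ i → f (fsuc i))

below : ∀ {n} → Subset n → Fin n → ℕ
below A j = count (λ a → lookup A a ∧ (toℕ a <ᵇ toℕ j))

-- In the monomial θ_A ξ_B ρ_C, the variable θ_j is preceded
-- by below A j factors, ξ_j by ∣A∣ + below B j factors and ρ_j by
-- ∣A∣ + ∣B∣ + below C j factors.  Hence  ∂ sends (monomial containing the
-- variable) to (-1)^{#preceding factors} · (monomial without it), and the
-- coefficient of M in ∂ p is the signed coefficient in p of M with the
-- variable adjoined (or 0 if M already contains the variable).

∂θ : ∀ {n} → Fin n → Poly n → Poly n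
∂θ j p (A , B , C) =
  if lookup A j then 0ℚ else sgnPow (below A j) * p (A [ j ]≔ true , B , C)

∂ξ : ∀ {n} → Fin n → Poly n → Poly n
∂ξ j p (A , B , C) =
  if lookup B j then 0ℚ else sgnPow (∣ A ∣ + below B j) * p (A , B [ j ]≔ true , C)

∂ρ : ∀ {n} → Fin n → Poly n → Poly n
∂ρ j p (A , B , C) =
  if lookup C j then 0ℚ
  else sgnPow (∣ A ∣ + ∣ B ∣ + below C j) * p (A , B , C [ j ]≔ true)

D : ∀ {n} → Bool → Bool → Bool → Fin n → Poly n → Poly n
D h k l i p =
  (if h then ∂θ i else (λ q → q))
    ((if k then ∂ξ i else (λ q → q))
      ((if l then ∂ρ i else (λ q → q)) p))

InT : ∀ {n} → Poly n → Set
InT {n} p = ∀ (h k l : Bool) → (h ∨ k ∨ l) ≡ true →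
  ∀ (M : Mono n) → sumFin (λ i → D h k l i p M) ≡ 0ℚ

inv : ∀ {n} → Permutation′ n → Subset n → ℕ
inv σ A = sumℕ (λ a → count (λ b →
  lookup A a ∧ lookup A b ∧ (toℕ a <ᵇ toℕ b) ∧ (toℕ (σ ⟨$⟩ʳ b) <ᵇ toℕ (σ ⟨$⟩ʳ a))))

sgn : ∀ {n} → Permutation′ n → ℚ
sgn σ = sgnPow (inv σ (tabulate (λ _ → true)))

pre : ∀ {n} → Permutation′ n → Subset n → Subset n
pre σ A = tabulate (λ a → lookup A (σ ⟨$⟩ʳ a))

-- σ(θ_A ξ_B ρ_C) = θ_{σa₁}⋯θ_{σa_r} ξ_{σb₁}⋯ ρ_{σc₁}⋯ ; reordering each block
-- increasingly gives (-1)^{inv σ A + inv σ B + inv σ C} θ_{σA} ξ_{σB} ρ_{σC}.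
act : ∀ {n} → Permutation′ n → Poly n → Poly n
act σ p (A' , B' , C') =
  let A = pre σ A' ; B = pre σ B' ; C = pre σ C' in
  sgnPow (inv σ A + inv σ B + inv σ C) * p (A , B , C)

Antisymmetric : ∀ {n} → Poly n → Set
Antisymmetric {n} p = ∀ (σ : Permutation′ n) (M : Mono n) → act σ p M ≡ sgn σ * p M

Nonzero : ∀ {n} → Poly n → Set
Nonzero {n} p = ∃ λ (M : Mono n) → p M ≢ 0ℚ

InΘ : ∀ {n} → Poly n → Set
InΘ {n} p = ∀ (A B C : Subset n) → p (A , B , C) ≢ 0ℚ → (B ≡ ∅) × (C ≡ ∅)

InΘΞ : ∀ {n} → Poly n → Set
InΘΞ {n} p = ∀ (A B C : Subset n) → p (A , B , C) ≢ 0ℚ → C ≡ ∅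

HasDegree : ∀ {n} → Poly n → ℕ → Set
HasDegree {n} p d =
  (∃ λ (M : Mono n) → (p M ≢ 0ℚ) × (deg M ≡ d)) ×
  (∀ (M : Mono n) → p M ≢ 0ℚ → deg M ≤ d)

-- Write c(A, B) for the coefficient of θ_A ξ_B and give each index i the type (i ∈ A, i ∈ B).
-- Antisymmetry under an adjacent transposition relates c(A, B) and c(τA, τB) by an explicit sign.
-- Hence two indices of type (0,0), or two of type (1,1), force c = 0, and every transposition
-- preserves c ≠ 0; so at most one index has weight 0 and the degree is at least n − 1.
-- In degree ≥ n a nonzero c would have (a) one index of type (1,1) and none of type (0,0),
-- (b) only types (1,0) and (0,1), or (c) one index of each of the types (0,0) and (1,1).
-- In (a), Σᵢ ∂θᵢ ∂ξᵢ p = 0 at θ_{A−u} ξ_{B−u} has the single term ± c(A, B).  In (b) and (c),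
-- sorting the indices by type (1,0) < (0,0) < (1,1) < (0,1) gives θ_{≤u} ξ_{>u} (or a pure θ or
-- pure ξ monomial, again a single-term case), resp. θ_{<u} θ_{u+1} ξ_{>u}.  With a₀ and G their
-- coefficients, adjacent swaps identify every term of Σᵢ ∂θᵢ p = 0 at θ_{<u} ξ_{>u} and of
-- Σᵢ ∂ξᵢ p = 0 at θ_{≤u} ξ_{>u+1} with ± a₀ or ± G; the equations read a₀ + (n − 1 − u) G = 0
-- and a₀ − (u + 1) G = 0, so n G = 0 and, over ℚ, a₀ = G = 0.

module Submission where

open import Defs
open import Data.Nat using (ℕ; _∸_)
open import Data.Product using (_×_)

open import Algebra.Bundles using (CommutativeMonoid; CommutativeRing)
import Algebra.Properties.CommutativeMonoid.Sum as CommutativeMonoidSum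
import Algebra.Properties.Semiring.Sum as SemiringSum
open import Data.Bool using (Bool; true; false; if_then_else_; _∧_; _∨_; not)
import Data.Bool.Properties as BoolP
open import Data.Empty using (⊥; ⊥-elim)
open import Data.Fin using (Fin; toℕ; punchIn; _<_; fromℕ<) renaming (zero to fzero; suc to fsuc)
open import Data.Fin.Permutation using (Permutation′; _⟨$⟩ʳ_; transpose; lift₀-transpose)
import Data.Fin.Permutation.Components as PC
import Data.Fin.Properties as FinP
open import Data.Fin.Subset using (Subset; ∣_∣) renaming (⊥ to ∅)
import Data.Fin.Subset.Properties as SubsetP
open import Data.Nat as ℕ using (zero; suc; _+_; _≤_; z≤n; s≤s; _<ᵇ_)
import Data.Nat.Properties as ℕP
open import Data.Product using (_,_; proj₁; proj₂; ∃-syntax)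
import Data.Product.Properties as ×P
open import Data.Rational as ℚ using (ℚ; 0ℚ; 1ℚ; _*_; -_; 1/_; NonZero) renaming (_+_ to _+ℚ_)
import Data.Rational.Properties as ℚP
open import Algebra.Properties.Ring ℚP.+-*-ring using (-1*x≈-x)
open import Data.Rational.Solver using (module +-*-Solver)
open import Data.Sum using (_⊎_; inj₁; inj₂)
open import Data.Vec using ([]; _∷_; lookup; tabulate; _[_]≔_)
import Data.Vec.Properties as VP
open import Data.Vec.Functional using (removeAt; replicate; updateAt) renaming (_∷_ to _∷ᶠ_)
import Data.Vec.Functional.Properties as VFP
open import Function using (_∘_; const)
open import Function.Bundles using (Equivalence)
open import Relation.Binary using (tri<; tri≈; tri>)
open import Relation.Binary.PropositionalEquality
  using (_≡_; _≢_; _≗_; refl; sym; trans; cong; cong₂; subst; subst₂; module ≡-Reasoning)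
open import Relation.Nullary using (Dec; yes; no; ¬_; does)
open import Relation.Nullary.Decidable using (dec-true; dec-false)

open +-*-Solver using (solve; _:=_; _:+_; _:*_; :-_)

-- Finite sums and signs

iverson : Bool → ℕ
iverson b = if b then 1 else 0

module _ {c ℓ} (M : CommutativeMonoid c ℓ) where
  open CommutativeMonoid M using (Carrier; _≈_; _∙_; ε; ∙-congˡ; identityʳ; setoid)
  open CommutativeMonoidSum M
  open import Relation.Binary.Reasoning.Setoid setoid

  sum-zero : ∀ {n} (t : Fin n → Carrier) → (∀ i → t i ≈ ε) → sum t ≈ ε
  sum-zero {n} t t≈ε = begin
    sum t                ≈⟨ sum-cong-≋ t≈ε ⟩
    sum (replicate n ε)  ≈⟨ sum-replicate-zero n ⟩
    ε                    ∎

  sum-single : ∀ {n} (t : Fin n → Carrier) j → (∀ i → i ≢ j → t i ≈ ε) → sum t ≈ t j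
  sum-single {suc n} t j others = begin
    sum t                     ≈⟨ sum-remove t ⟩
    t j ∙ sum (removeAt t j)  ≈⟨ ∙-congˡ (sum-zero _ (λ k → others _ (FinP.punchInᵢ≢i j k))) ⟩
    t j ∙ ε                   ≈⟨ identityʳ (t j) ⟩
    t j                       ∎

module ℕΣ = CommutativeMonoidSum ℕP.+-0-commutativeMonoid
module ℚΣ = SemiringSum (CommutativeRing.semiring ℚP.+-*-commutativeRing)

sumFin≡sum : ∀ {n} (t : Fin n → ℚ) → sumFin t ≡ ℚΣ.sum t
sumFin≡sum {zero} t = refl
sumFin≡sum {suc n} t = cong (t fzero +ℚ_) (sumFin≡sum (t ∘ fsuc))

sumℕ≡sum : ∀ {n} (t : Fin n → ℕ) → sumℕ t ≡ ℕΣ.sum t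
sumℕ≡sum {zero} t = refl
sumℕ≡sum {suc n} t = cong (t fzero +_) (sumℕ≡sum (t ∘ fsuc))

count≡sum : ∀ {n} (P : Fin n → Bool) → count P ≡ ℕΣ.sum (iverson ∘ P)
count≡sum {zero} P = refl
count≡sum {suc n} P = cong (iverson (P fzero) +_) (count≡sum (P ∘ fsuc))

count-cong : ∀ {n} {P Q : Fin n → Bool} → P ≗ Q → count P ≡ count Q
count-cong {P = P} {Q} P≗Q =
  trans (count≡sum P) (trans (ℕΣ.sum-cong-≗ (cong iverson ∘ P≗Q)) (sym (count≡sum Q)))

∣∣≡sum : ∀ {n} (A : Subset n) → ∣ A ∣ ≡ ℕΣ.sum (iverson ∘ lookup A)
∣∣≡sum [] = refl
∣∣≡sum (true ∷ A) = cong suc (∣∣≡sum A)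
∣∣≡sum (false ∷ A) = ∣∣≡sum A

sum-neg : ∀ {n} (t : Fin n → ℚ) → ℚΣ.sum (λ i → - t i) ≡ - ℚΣ.sum t
sum-neg {zero} t = refl
sum-neg {suc n} t = trans (cong (- t fzero +ℚ_) (sum-neg (t ∘ fsuc)))
                          (sym (ℚP.neg-distrib-+ (t fzero) (ℚΣ.sum (t ∘ fsuc))))

sum-const≡0⇒≡0 : ∀ {n} → Fin n → ∀ x → ℚΣ.sum {n} (λ _ → x) ≡ 0ℚ → x ≡ 0ℚ
sum-const≡0⇒≡0 {suc m} _ x Σx≡0 = begin
  x                  ≡⟨ sym (ℚP.*-identityˡ x) ⟩
  1ℚ * x             ≡⟨ cong (_* x) (sym (ℚP.*-inverseˡ N)) ⟩
  (1/ N * N) * x     ≡⟨ ℚP.*-assoc (1/ N) N x ⟩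
  1/ N * (N * x)     ≡⟨ cong (1/ N *_) Nx≡0 ⟩
  1/ N * 0ℚ          ≡⟨ ℚP.*-zeroʳ (1/ N) ⟩
  0ℚ                 ∎
  where
  open ≡-Reasoning
  N = ℚΣ.sum {suc m} (λ _ → 1ℚ)
  ones≥0 : ∀ k → ℚ.NonNegative (ℚΣ.sum {k} (λ _ → 1ℚ))
  ones≥0 zero = _
  ones≥0 (suc k) = ℚP.nonNeg+nonNeg⇒nonNeg 1ℚ (ℚΣ.sum {k} (λ _ → 1ℚ)) {{ones≥0 k}}
  instance
    N≢0 : NonZero N
    N≢0 = ℚP.pos⇒nonZero N {{ℚP.pos+nonNeg⇒pos 1ℚ (ℚΣ.sum {m} (λ _ → 1ℚ)) {{ones≥0 m}}}}
  Nx≡0 : N * x ≡ 0ℚ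
  Nx≡0 = begin
    N * x                          ≡⟨ ℚΣ.*-distribʳ-sum {suc m} x (λ _ → 1ℚ) ⟩
    ℚΣ.sum {suc m} (λ _ → 1ℚ * x)  ≡⟨ ℚΣ.sum-cong-≋ {suc m} (λ _ → ℚP.*-identityˡ x) ⟩
    ℚΣ.sum {suc m} (λ _ → x)       ≡⟨ Σx≡0 ⟩
    0ℚ                             ∎

x≡-x⇒x≡0 : ∀ {x} → x ≡ - x → x ≡ 0ℚ
x≡-x⇒x≡0 {x} x≡-x = sum-const≡0⇒≡0 {2} fzero x (begin
  x +ℚ (x +ℚ 0ℚ)  ≡⟨ cong (x +ℚ_) (ℚP.+-identityʳ x) ⟩
  x +ℚ x          ≡⟨ cong (x +ℚ_) x≡-x ⟩
  x +ℚ - x        ≡⟨ ℚP.+-inverseʳ x ⟩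
  0ℚ              ∎)
  where open ≡-Reasoning

sgnPow² : ∀ k → sgnPow k * sgnPow k ≡ 1ℚ
sgnPow² zero = refl
sgnPow² (suc k) = trans (solve 1 (λ x → (:- x) :* (:- x) := x :* x) refl (sgnPow k)) (sgnPow² k)

sgnPow*≡0⇒≡0 : ∀ k {x} → sgnPow k * x ≡ 0ℚ → x ≡ 0ℚ
sgnPow*≡0⇒≡0 k {x} εx≡0 = begin
  x                          ≡⟨ sym (ℚP.*-identityˡ x) ⟩
  1ℚ * x                     ≡⟨ cong (_* x) (sym (sgnPow² k)) ⟩
  (sgnPow k * sgnPow k) * x  ≡⟨ ℚP.*-assoc (sgnPow k) (sgnPow k) x ⟩
  sgnPow k * (sgnPow k * x)  ≡⟨ cong (sgnPow k *_) εx≡0 ⟩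
  sgnPow k * 0ℚ              ≡⟨ ℚP.*-zeroʳ (sgnPow k) ⟩
  0ℚ                         ∎
  where open ≡-Reasoning

swap-sign-cong : ∀ {a b c d a′ b′ c′ d′ : Bool} → a ≡ a′ → b ≡ b′ → c ≡ c′ → d ≡ d′ →
                 sgnPow (iverson (a ∧ b) + iverson (c ∧ d)) ≡ sgnPow (iverson (a′ ∧ b′) + iverson (c′ ∧ d′))
swap-sign-cong refl refl refl refl = refl

sgnPow-repeated : ∀ b → sgnPow (iverson (b ∧ b) + iverson (b ∧ b)) ≡ 1ℚ
sgnPow-repeated true = refl
sgnPow-repeated false = refl

n≤sum : ∀ {n} (w : Fin n → ℕ) → (∀ i → 1 ≤ w i) → n ≤ ℕΣ.sum w
n≤sum {zero} w w≥1 = z≤n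
n≤sum {suc n} w w≥1 = ℕP.+-mono-≤ (w≥1 fzero) (n≤sum (w ∘ fsuc) (w≥1 ∘ fsuc))

sum≤n : ∀ {n} (w : Fin n → ℕ) → (∀ i → w i ≤ 1) → ℕΣ.sum w ≤ n
sum≤n {zero} w w≤1 = z≤n
sum≤n {suc n} w w≤1 = ℕP.+-mono-≤ (w≤1 fzero) (sum≤n (w ∘ fsuc) (w≤1 ∘ fsuc))

sum≡sum-removeAt : ∀ {n} (w : Fin (suc n) → ℕ) j → w j ≡ 0 → ℕΣ.sum w ≡ ℕΣ.sum (removeAt w j)
sum≡sum-removeAt w j wj≡0 = trans (ℕΣ.sum-remove w) (cong (_+ ℕΣ.sum (removeAt w j)) wj≡0)

n∸1≤sum : ∀ {n} (w : Fin n → ℕ) → (∀ i j → w i ≡ 0 → w j ≡ 0 → i ≡ j) → n ∸ 1 ≤ ℕΣ.sum w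
n∸1≤sum {zero} w _ = z≤n
n∸1≤sum {suc n} w zero-unique with FinP.any? (λ i → w i ℕ.≟ 0)
... | yes (j , wj≡0) =
  ℕP.≤-trans (n≤sum (removeAt w j) others≥1) (ℕP.≤-reflexive (sym (sum≡sum-removeAt w j wj≡0)))
  where
  others≥1 : ∀ k → 1 ≤ w (punchIn j k)
  others≥1 k = ℕP.n≢0⇒n>0 (λ w≡0 → FinP.punchInᵢ≢i j k (zero-unique _ _ w≡0 wj≡0))
... | no no-zero =
  ℕP.≤-trans (ℕP.n≤1+n n) (n≤sum w (λ i → ℕP.n≢0⇒n>0 (λ wi≡0 → no-zero (i , wi≡0))))

sum≤n∸1 : ∀ {n} (w : Fin n → ℕ) → (∀ i → w i ≤ 1) → ∀ j → w j ≡ 0 → ℕΣ.sum w ≤ n ∸ 1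
sum≤n∸1 {suc n} w w≤1 j wj≡0 =
  ℕP.≤-trans (ℕP.≤-reflexive (sum≡sum-removeAt w j wj≡0)) (sum≤n (removeAt w j) (w≤1 ∘ punchIn j))

<ᵇ≡true⇒< : ∀ {m n} → (m <ᵇ n) ≡ true → m ℕ.< n
<ᵇ≡true⇒< {m} {n} m<ᵇn = ℕP.<ᵇ⇒< m n (Equivalence.from BoolP.T-≡ m<ᵇn)

<⇒<ᵇ≡true : ∀ {m n} → m ℕ.< n → (m <ᵇ n) ≡ true
<⇒<ᵇ≡true m<n = Equivalence.to BoolP.T-≡ (ℕP.<⇒<ᵇ m<n)

≤⇒<ᵇ≡false : ∀ {m n} → n ≤ m → (m <ᵇ n) ≡ false
≤⇒<ᵇ≡false n≤m = BoolP.¬-not (λ m<ᵇn → ℕP.<⇒≱ (<ᵇ≡true⇒< m<ᵇn) n≤m)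

-- Transpositions

data TransposeView {n} (i j k : Fin n) : Set where
  at-i  : k ≡ i → PC.transpose i j k ≡ j → TransposeView i j k
  at-j  : k ≢ i → k ≡ j → PC.transpose i j k ≡ i → TransposeView i j k
  other : k ≢ i → k ≢ j → PC.transpose i j k ≡ k → TransposeView i j k

transposeView : ∀ {n} (i j k : Fin n) → TransposeView i j k
transposeView i j k with k FinP.≟ i
... | yes k≡i = at-i k≡i τk≡j
  where
  τk≡j : PC.transpose i j k ≡ j
  τk≡j rewrite dec-true (k FinP.≟ i) k≡i = refl
... | no k≢i with k FinP.≟ j
...   | yes k≡j = at-j k≢i k≡j τk≡i
  where
  τk≡i : PC.transpose i j k ≡ i
  τk≡i rewrite dec-false (k FinP.≟ i) k≢i | dec-true (k FinP.≟ j) k≡j = refl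
...   | no k≢j = other k≢i k≢j τk≡k
  where
  τk≡k : PC.transpose i j k ≡ k
  τk≡k rewrite dec-false (k FinP.≟ i) k≢i | dec-false (k FinP.≟ j) k≢j = refl

transpose-matchˡ : ∀ {n} (i j : Fin n) → PC.transpose i j i ≡ j
transpose-matchˡ i j with transposeView i j i
... | at-i _ τi≡j   = τi≡j
... | at-j i≢i _ _  = ⊥-elim (i≢i refl)
... | other i≢i _ _ = ⊥-elim (i≢i refl)

transpose-matchʳ : ∀ {n} (i j : Fin n) → PC.transpose i j j ≡ i
transpose-matchʳ i j with transposeView i j j
... | at-i refl τj≡j = τj≡j
... | at-j _ _ τj≡i  = τj≡i
... | other _ j≢j _  = ⊥-elim (j≢j refl)

transpose-other : ∀ {n} {i j k : Fin n} → k ≢ i → k ≢ j → PC.transpose i j k ≡ k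
transpose-other {i = i} {j} {k} k≢i k≢j with transposeView i j k
... | at-i k≡i _     = ⊥-elim (k≢i k≡i)
... | at-j _ k≡j _   = ⊥-elim (k≢j k≡j)
... | other _ _ τk≡k = τk≡k

∘transpose-≗ : ∀ {n} {A : Set} (f : Fin n → A) {i j} → f i ≡ f j → f ∘ PC.transpose i j ≗ f
∘transpose-≗ f {i} {j} fi≡fj k with transposeView i j k
... | at-i refl τk≡j   = trans (cong f τk≡j) (sym fi≡fj)
... | at-j _ refl τk≡i = trans (cong f τk≡i) fi≡fj
... | other _ _ τk≡k   = cong f τk≡k

updateAt-∘transpose : ∀ {n} {A : Set} (f : Fin n → A) {i j} x → f i ≡ f j →
                      updateAt f j (const x) ∘ PC.transpose i j ≗ updateAt f i (const x)
updateAt-∘transpose f {i} {j} x fi≡fj k with transposeView i j k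
... | at-i refl τk≡j = begin
  updateAt f j (const x) (PC.transpose k j k)  ≡⟨ cong (updateAt f j (const x)) τk≡j ⟩
  updateAt f j (const x) j                     ≡⟨ VFP.updateAt-updates j f ⟩
  x                                            ≡⟨ sym (VFP.updateAt-updates k f) ⟩
  updateAt f k (const x) k                     ∎
  where open ≡-Reasoning
... | at-j k≢i refl τk≡i = begin
  updateAt f k (const x) (PC.transpose i k k)  ≡⟨ cong (updateAt f k (const x)) τk≡i ⟩
  updateAt f k (const x) i                     ≡⟨ VFP.updateAt-minimal i k f (k≢i ∘ sym) ⟩
  f i                                          ≡⟨ fi≡fj ⟩
  f k                                          ≡⟨ sym (VFP.updateAt-minimal k i f k≢i) ⟩
  updateAt f i (const x) k                     ∎
  where open ≡-Reasoning
... | other k≢i k≢j τk≡k = begin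
  updateAt f j (const x) (PC.transpose i j k)  ≡⟨ cong (updateAt f j (const x)) τk≡k ⟩
  updateAt f j (const x) k                     ≡⟨ VFP.updateAt-minimal k j f k≢j ⟩
  f k                                          ≡⟨ sym (VFP.updateAt-minimal k i f k≢i) ⟩
  updateAt f i (const x) k                     ∎
  where open ≡-Reasoning

updateAt-restore : ∀ {n} {A : Set} (f : Fin n → A) i {x y} → f i ≡ y →
                   updateAt (updateAt f i (const x)) i (const y) ≗ f
updateAt-restore f i fi≡y k =
  trans (VFP.updateAt-updateAt-local i f (sym fi≡y) k) (VFP.updateAt-id i f k)

Adjacent : ∀ {n} → Fin n → Fin n → Set
Adjacent u v = toℕ v ≡ suc (toℕ u)

module _ {n} {u v : Fin n} (u~v : Adjacent u v) where

  adjacent⇒< : u < v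
  adjacent⇒< = ℕP.≤-reflexive (sym u~v)

  nothing-between : ∀ {x : Fin n} → u < x → x < v → ⊥
  nothing-between {x} u<x x<v = ℕP.<⇒≱ u<x (ℕP.≤-pred (subst (toℕ x ℕ.<_) u~v x<v))

  inversion⇒adjacent-pair : ∀ {a b} → a < b → PC.transpose u v b < PC.transpose u v a → a ≡ u × b ≡ v
  inversion⇒adjacent-pair {a} {b} a<b τb<τa = go (transposeView u v a) (transposeView u v b)
    where
    u<v = adjacent⇒<
    inverted : ∀ {x y} → PC.transpose u v a ≡ x → PC.transpose u v b ≡ y → y < x
    inverted refl refl = τb<τa
    go : TransposeView u v a → TransposeView u v b → a ≡ u × b ≡ v
    go (at-i refl _)    (at-i refl _)    = ⊥-elim (ℕP.<-irrefl refl a<b)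
    go (at-i refl _)    (at-j _ refl _)  = refl , refl
    go (at-i refl τa)   (other _ _ τb)   = ⊥-elim (nothing-between a<b (inverted τa τb))
    go (at-j _ refl _)  (at-i refl _)    = ⊥-elim (ℕP.<-asym u<v a<b)
    go (at-j _ refl _)  (at-j _ refl _)  = ⊥-elim (ℕP.<-irrefl refl a<b)
    go (at-j _ refl τa) (other _ _ τb)   = ⊥-elim (ℕP.<-asym (inverted τa τb) (ℕP.<-trans u<v a<b))
    go (other _ _ τa)   (at-i refl τb)   = ⊥-elim (ℕP.<-asym (inverted τa τb) (ℕP.<-trans a<b u<v))
    go (other _ _ τa)   (at-j _ refl τb) = ⊥-elim (nothing-between (inverted τa τb) a<b)
    go (other _ _ τa)   (other _ _ τb)   = ⊥-elim (ℕP.<-asym a<b (inverted τa τb))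

  inv-adjacent : ∀ S → inv (transpose u v) S ≡ iverson (lookup S u ∧ lookup S v)
  inv-adjacent S = begin
    sumℕ row
      ≡⟨ sumℕ≡sum row ⟩
    ℕΣ.sum row
      ≡⟨ sum-single ℕP.+-0-commutativeMonoid row u row-others ⟩
    count (entry u)
      ≡⟨ count≡sum (entry u) ⟩
    ℕΣ.sum (iverson ∘ entry u)
      ≡⟨ sum-single ℕP.+-0-commutativeMonoid (iverson ∘ entry u) v
                    (λ b b≢v → cong iverson (entry≡false (b≢v ∘ proj₂))) ⟩
    iverson (entry u v)
      ≡⟨ cong iverson entry-uv ⟩
    iverson (lookup S u ∧ lookup S v) ∎
    where
    open ≡-Reasoning
    τ = PC.transpose u v
    inverted : Fin n → Fin n → Bool
    inverted a b = (toℕ a <ᵇ toℕ b) ∧ (toℕ (τ b) <ᵇ toℕ (τ a))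
    entry : Fin n → Fin n → Bool
    entry a b = lookup S a ∧ lookup S b ∧ inverted a b
    row : Fin n → ℕ
    row a = count (entry a)
    entry≡false : ∀ {a b} → ¬ (a ≡ u × b ≡ v) → entry a b ≡ false
    entry≡false {a} {b} not-uv = begin
      lookup S a ∧ lookup S b ∧ inverted a b  ≡⟨ cong (λ x → lookup S a ∧ lookup S b ∧ x) inverted≡false ⟩
      lookup S a ∧ lookup S b ∧ false         ≡⟨ cong (lookup S a ∧_) (BoolP.∧-zeroʳ (lookup S b)) ⟩
      lookup S a ∧ false                      ≡⟨ BoolP.∧-zeroʳ (lookup S a) ⟩
      false                                   ∎
      where
      inverted≡false : inverted a b ≡ false
      inverted≡false = BoolP.¬-not λ inv≡true →
        let (a<b , τb<τa) = Equivalence.to BoolP.T-∧ (Equivalence.from BoolP.T-≡ inv≡true)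
        in not-uv (inversion⇒adjacent-pair (ℕP.<ᵇ⇒< _ _ a<b) (ℕP.<ᵇ⇒< _ _ τb<τa))
    row-others : ∀ a → a ≢ u → row a ≡ 0
    row-others a a≢u = trans (count≡sum (entry a))
      (sum-zero ℕP.+-0-commutativeMonoid (iverson ∘ entry a) (λ b → cong iverson (entry≡false (a≢u ∘ proj₁))))
    entry-uv : entry u v ≡ lookup S u ∧ lookup S v
    entry-uv = begin
      lookup S u ∧ lookup S v ∧ (toℕ u <ᵇ toℕ v) ∧ (toℕ (τ v) <ᵇ toℕ (τ u))
        ≡⟨ cong₂ (λ x y → lookup S u ∧ lookup S v ∧ x ∧ (toℕ y <ᵇ toℕ (τ u)))
                 (<⇒<ᵇ≡true adjacent⇒<) (transpose-matchʳ u v) ⟩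
      lookup S u ∧ lookup S v ∧ (toℕ u <ᵇ toℕ (τ u))
        ≡⟨ cong (λ y → lookup S u ∧ lookup S v ∧ (toℕ u <ᵇ toℕ y)) (transpose-matchˡ u v) ⟩
      lookup S u ∧ lookup S v ∧ (toℕ u <ᵇ toℕ v)
        ≡⟨ cong (λ x → lookup S u ∧ lookup S v ∧ x) (<⇒<ᵇ≡true adjacent⇒<) ⟩
      lookup S u ∧ lookup S v ∧ true
        ≡⟨ cong (lookup S u ∧_) (BoolP.∧-identityʳ (lookup S v)) ⟩
      lookup S u ∧ lookup S v ∎

adjacent-successor : ∀ {n} {u w : Fin n} → u < w → ∃[ v ] Adjacent u v
adjacent-successor {u = u} {w} u<w = fromℕ< (ℕP.≤-<-trans u<w (FinP.toℕ<n w)) , FinP.toℕ-fromℕ< _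

adjacent-chain : ∀ {n} {A : Set} (φ : Fin n → A) (lo hi : ℕ) →
  (∀ {k k′} → Adjacent k k′ → lo ≤ toℕ k → toℕ k′ ≤ hi → φ k ≡ φ k′) →
  ∀ {i j} → lo ≤ toℕ i → toℕ i ≤ toℕ j → toℕ j ≤ hi → φ i ≡ φ j
adjacent-chain {n} φ lo hi step {i} {j} lo≤i i≤j j≤hi =
  walk (toℕ j ∸ toℕ i) (sym (ℕP.m∸n+n≡m i≤j)) j≤hi
  where
  walk : ∀ d {j} → toℕ j ≡ d + toℕ i → toℕ j ≤ hi → φ i ≡ φ j
  walk zero j≡i _ = cong φ (FinP.toℕ-injective (sym j≡i))
  walk (suc d) {j} j≡1+d+i j≤hi = trans (walk d {k} k≡d+i (ℕP.<⇒≤ k<hi)) (step k~j lo≤k j≤hi)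
    where
    d+i<n : d + toℕ i ℕ.< n
    d+i<n = ℕP.<-trans (ℕP.n<1+n _) (subst (ℕ._< n) j≡1+d+i (FinP.toℕ<n j))
    k = fromℕ< d+i<n
    k≡d+i : toℕ k ≡ d + toℕ i
    k≡d+i = FinP.toℕ-fromℕ< d+i<n
    k~j : Adjacent k j
    k~j = trans j≡1+d+i (cong suc (sym k≡d+i))
    lo≤k : lo ≤ toℕ k
    lo≤k = ℕP.≤-trans lo≤i (ℕP.≤-trans (ℕP.m≤n+m (toℕ i) d) (ℕP.≤-reflexive (sym k≡d+i)))
    k<hi : toℕ k ℕ.< hi
    k<hi = ℕP.≤-trans (ℕP.≤-reflexive (sym k~j)) j≤hi

module Sorting {X : Set} (rank : X → ℕ) where

  Sorted : ∀ {n} → (Fin n → X) → Set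
  Sorted t = ∀ i j → toℕ i ≤ toℕ j → rank (t i) ≤ rank (t j)

  argmin : ∀ {n} (t : Fin (suc n) → X) → ∃[ m ] ∀ i → rank (t m) ≤ rank (t i)
  argmin {zero} t = fzero , λ { fzero → ℕP.≤-refl }
  argmin {suc n} t with argmin (t ∘ fsuc)
  ... | m , min with rank (t fzero) ℕ.≤? rank (t (fsuc m))
  ...   | yes t₀≤ = fzero , λ { fzero → ℕP.≤-refl ; (fsuc i) → ℕP.≤-trans t₀≤ (min i) }
  ...   | no t₀≰  = fsuc m , λ { fzero → ℕP.<⇒≤ (ℕP.≰⇒> t₀≰) ; (fsuc i) → min i }

  sorted-∷ : ∀ {n h} {s : Fin n → X} → (∀ i → rank h ≤ rank (s i)) → Sorted s → Sorted (h ∷ᶠ s)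
  sorted-∷ h-min s-sorted fzero fzero _ = ℕP.≤-refl
  sorted-∷ h-min s-sorted fzero (fsuc j) _ = h-min j
  sorted-∷ h-min s-sorted (fsuc i) (fsuc j) (s≤s i≤j) = s-sorted i j i≤j

  sorted-witness : ∀ {n} (P : (Fin n → X) → Set) →
    (∀ {t t′} → t ≗ t′ → P t → P t′) →
    (∀ {t} i j → P t → P (t ∘ PC.transpose i j)) →
    ∀ {t} → P t → ∃[ t′ ] P t′ × Sorted t′
  sorted-witness {zero} P resp swap {t} Pt = t , Pt , λ ()
  sorted-witness {suc n} P resp swap {t} Pt =
    let (s , (P-h∷s , h-min) , s-sorted) = sorted-witness P′ resp′ swap′ P′-tail
    in h ∷ᶠ s , P-h∷s , sorted-∷ h-min s-sorted
    where
    m = proj₁ (argmin t)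
    h = t m
    P′ : (Fin n → X) → Set
    P′ s = P (h ∷ᶠ s) × (∀ i → rank h ≤ rank (s i))
    resp′ : ∀ {s s′} → s ≗ s′ → P′ s → P′ s′
    resp′ s≗s′ (P-h∷s , h-min) =
        resp (λ { fzero → refl ; (fsuc i) → s≗s′ i }) P-h∷s
      , λ i → subst (λ x → rank h ≤ rank x) (s≗s′ i) (h-min i)
    swap′ : ∀ {s} i j → P′ s → P′ (s ∘ PC.transpose i j)
    swap′ {s} i j (P-h∷s , h-min) = resp lift (swap (fsuc i) (fsuc j) P-h∷s) , h-min ∘ PC.transpose i j
      where
      lift : (h ∷ᶠ s) ∘ PC.transpose (fsuc i) (fsuc j) ≗ h ∷ᶠ (s ∘ PC.transpose i j)
      lift fzero = cong (h ∷ᶠ s) (lift₀-transpose i j fzero)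
      lift (fsuc k) = cong (h ∷ᶠ s) (lift₀-transpose i j (fsuc k))
    P′-tail : P′ (t ∘ PC.transpose fzero m ∘ fsuc)
    P′-tail = resp (λ { fzero → cong t (transpose-matchˡ fzero m) ; (fsuc i) → refl }) (swap fzero m Pt)
            , λ i → proj₂ (argmin t) _

monotone⇒threshold : ∀ {m} (h : Fin m → Bool) →
                     (∀ i j → toℕ i ≤ toℕ j → h i ≡ true → h j ≡ true) →
                     ∃[ k ] ∀ i → h i ≡ not (toℕ i <ᵇ k)
monotone⇒threshold {zero} h mono = 0 , λ ()
monotone⇒threshold {suc m} h mono with h fzero in h₀
... | true = 0 , λ i → mono fzero i z≤n h₀
... | false with monotone⇒threshold (h ∘ fsuc) (λ i j i≤j → mono (fsuc i) (fsuc j) (s≤s i≤j))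
...   | k , threshold = suc k , λ { fzero → h₀ ; (fsuc i) → threshold i }

-- Coefficients and their derivatives

tabulate-updateAt : ∀ {n} {A : Set} (f : Fin n → A) i x →
                    tabulate f [ i ]≔ x ≡ tabulate (updateAt f i (const x))
tabulate-updateAt {suc n} f fzero x = refl
tabulate-updateAt {suc n} f (fsuc i) x = cong (f fzero ∷_) (tabulate-updateAt (f ∘ fsuc) i x)

tabulate-false : ∀ {n} → tabulate {n = n} (λ _ → false) ≡ ∅
tabulate-false {zero} = refl
tabulate-false {suc n} = cong (false ∷_) tabulate-false

pre-tabulate : ∀ {n} (σ : Permutation′ n) f → pre σ (tabulate f) ≡ tabulate (f ∘ (σ ⟨$⟩ʳ_))
pre-tabulate σ f = VP.tabulate-cong (λ a → VP.lookup∘tabulate f (σ ⟨$⟩ʳ a))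

pre-∅ : ∀ {n} (σ : Permutation′ n) → pre σ ∅ ≡ ∅
pre-∅ σ = trans (VP.tabulate-cong (λ a → VP.lookup-replicate (σ ⟨$⟩ʳ a) false)) tabulate-false

below-stable : ∀ {n} (A : Subset n) {i j : Fin n} → toℕ i ≤ toℕ j →
               (∀ a → toℕ i ≤ toℕ a → a < j → lookup A a ≡ false) → below A i ≡ below A j
below-stable A {i} {j} i≤j gap = count-cong pointwise
  where
  pointwise : ∀ a → (lookup A a ∧ (toℕ a <ᵇ toℕ i)) ≡ (lookup A a ∧ (toℕ a <ᵇ toℕ j))
  pointwise a with toℕ a ℕ.<? toℕ i | toℕ a ℕ.<? toℕ j
  ... | yes a<i | _ =
    cong (lookup A a ∧_) (trans (<⇒<ᵇ≡true a<i) (sym (<⇒<ᵇ≡true (ℕP.<-≤-trans a<i i≤j))))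
  ... | no a≮i | yes a<j rewrite gap a (ℕP.≮⇒≥ a≮i) a<j = refl
  ... | no a≮i | no a≮j =
    cong (lookup A a ∧_) (trans (≤⇒<ᵇ≡false (ℕP.≮⇒≥ a≮i)) (sym (≤⇒<ᵇ≡false (ℕP.≮⇒≥ a≮j))))

module _ {n} (r : Poly n) where

  ∂θ-occupied : ∀ {j} (f : Fin n → Bool) B C → f j ≡ true → ∂θ j r (tabulate f , B , C) ≡ 0ℚ
  ∂θ-occupied {j} f B C fj≡true rewrite VP.lookup∘tabulate f j | fj≡true = refl

  ∂θ-vacant : ∀ {j} (f : Fin n → Bool) B C → f j ≡ false →
              ∂θ j r (tabulate f , B , C)
                ≡ sgnPow (below (tabulate f) j) * r (tabulate (updateAt f j (const true)) , B , C)
  ∂θ-vacant {j} f B C fj≡false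
    rewrite VP.lookup∘tabulate f j | fj≡false | tabulate-updateAt f j true = refl

  ∂ξ-occupied : ∀ {j} A (g : Fin n → Bool) C → g j ≡ true → ∂ξ j r (A , tabulate g , C) ≡ 0ℚ
  ∂ξ-occupied {j} A g C gj≡true rewrite VP.lookup∘tabulate g j | gj≡true = refl

  ∂ξ-vacant : ∀ {j} A (g : Fin n → Bool) C → g j ≡ false →
              ∂ξ j r (A , tabulate g , C)
                ≡ sgnPow (∣ A ∣ + below (tabulate g) j) * r (A , tabulate (updateAt g j (const true)) , C)
  ∂ξ-vacant {j} A g C gj≡false
    rewrite VP.lookup∘tabulate g j | gj≡false | tabulate-updateAt g j true = refl

coeff : ∀ {n} → Poly n → (Fin n → Bool) → (Fin n → Bool) → ℚ
coeff p f g = p (tabulate f , tabulate g , ∅)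

coeff-cong : ∀ {n} (p : Poly n) {f f′ g g′ : Fin n → Bool} →
             f ≗ f′ → g ≗ g′ → coeff p f g ≡ coeff p f′ g′
coeff-cong p f≗f′ g≗g′ = cong₂ (λ A B → p (A , B , ∅)) (VP.tabulate-cong f≗f′) (VP.tabulate-cong g≗g′)

δ : ∀ {n} → Fin n → ℚ → Fin n → ℚ
δ j x i = if does (i FinP.≟ j) then x else 0ℚ

δ-≡ : ∀ {n} {j : Fin n} {x} → δ j x j ≡ x
δ-≡ {j = j} {x} = cong (if_then x else 0ℚ) (dec-true (j FinP.≟ j) refl)

δ-≢ : ∀ {n} {i j : Fin n} {x} → i ≢ j → δ j x i ≡ 0ℚ
δ-≢ {i = i} {j} {x} i≢j = cong (if_then x else 0ℚ) (dec-false (i FinP.≟ j) i≢j)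

-- Harmonicity

module _ {n} {p : Poly n} (harmonic : InT p) where

  harmonic-single : ∀ {h k l} → (h ∨ k ∨ l) ≡ true → ∀ M j →
                    (∀ i → i ≢ j → D h k l i p M ≡ 0ℚ) → D h k l j p M ≡ 0ℚ
  harmonic-single {h} {k} {l} hkl M j others = begin
    D h k l j p M                 ≡⟨ sym (sum-single ℚP.+-0-commutativeMonoid (λ i → D h k l i p M) j others) ⟩
    ℚΣ.sum (λ i → D h k l i p M)  ≡⟨ sym (sumFin≡sum (λ i → D h k l i p M)) ⟩
    sumFin (λ i → D h k l i p M)  ≡⟨ harmonic h k l hkl M ⟩
    0ℚ                            ∎
    where open ≡-Reasoning

  harmonic⇒x+sum≡0 : ∀ {h k l} → (h ∨ k ∨ l) ≡ true → ∀ M s j x (e : Fin n → ℚ) →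
                     (∀ i → D h k l i p M ≡ sgnPow s * (δ j x i +ℚ e i)) → x +ℚ ℚΣ.sum e ≡ 0ℚ
  harmonic⇒x+sum≡0 {h} {k} {l} hkl M s j x e terms = sgnPow*≡0⇒≡0 s (begin
    sgnPow s * (x +ℚ ℚΣ.sum e)
      ≡⟨ cong (λ y → sgnPow s * (y +ℚ ℚΣ.sum e)) Σδ≡x ⟩
    sgnPow s * (ℚΣ.sum (δ j x) +ℚ ℚΣ.sum e)
      ≡⟨ cong (sgnPow s *_) (sym (ℚΣ.∑-distrib-+ (δ j x) e)) ⟩
    sgnPow s * ℚΣ.sum (λ i → δ j x i +ℚ e i)
      ≡⟨ ℚΣ.*-distribˡ-sum (sgnPow s) (λ i → δ j x i +ℚ e i) ⟩
    ℚΣ.sum (λ i → sgnPow s * (δ j x i +ℚ e i))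
      ≡⟨ ℚΣ.sum-cong-≗ (sym ∘ terms) ⟩
    ℚΣ.sum (λ i → D h k l i p M)
      ≡⟨ sym (sumFin≡sum (λ i → D h k l i p M)) ⟩
    sumFin (λ i → D h k l i p M)
      ≡⟨ harmonic h k l hkl M ⟩
    0ℚ ∎)
    where
    open ≡-Reasoning
    Σδ≡x : x ≡ ℚΣ.sum (δ j x)
    Σδ≡x = sym (trans (sum-single ℚP.+-0-commutativeMonoid (δ j x) j (λ i → δ-≢ {i = i})) (δ-≡ {j = j}))

  all-θ⇒coeff≡0 : ∀ {f g} → Fin n → (∀ i → f i ≡ true) → coeff p f g ≡ 0ℚ
  all-θ⇒coeff≡0 {f} {g} j all-θ = sgnPow*≡0⇒≡0 s (begin
    sgnPow s * coeff p f g
      ≡⟨ cong (sgnPow s *_) (coeff-cong p (sym ∘ updateAt-restore f j (all-θ j)) (λ _ → refl)) ⟩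
    sgnPow s * coeff p (updateAt f′ j (const true)) g
      ≡⟨ sym (∂θ-vacant p f′ (tabulate g) ∅ (VFP.updateAt-updates j f)) ⟩
    ∂θ j p (tabulate f′ , tabulate g , ∅)
      ≡⟨ harmonic-single {true} {false} {false} refl (tabulate f′ , tabulate g , ∅) j others ⟩
    0ℚ ∎)
    where
    open ≡-Reasoning
    f′ = updateAt f j (const false)
    s = below (tabulate f′) j
    others : ∀ i → i ≢ j → ∂θ i p (tabulate f′ , tabulate g , ∅) ≡ 0ℚ
    others i i≢j = ∂θ-occupied p f′ (tabulate g) ∅ (trans (VFP.updateAt-minimal i j f i≢j) (all-θ i))

  all-ξ⇒coeff≡0 : ∀ {f g} → Fin n → (∀ i → g i ≡ true) → coeff p f g ≡ 0ℚ
  all-ξ⇒coeff≡0 {f} {g} j all-ξ = sgnPow*≡0⇒≡0 s (begin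
    sgnPow s * coeff p f g
      ≡⟨ cong (sgnPow s *_) (coeff-cong p (λ _ → refl) (sym ∘ updateAt-restore g j (all-ξ j))) ⟩
    sgnPow s * coeff p f (updateAt g′ j (const true))
      ≡⟨ sym (∂ξ-vacant p (tabulate f) g′ ∅ (VFP.updateAt-updates j g)) ⟩
    ∂ξ j p (tabulate f , tabulate g′ , ∅)
      ≡⟨ harmonic-single {false} {true} {false} refl (tabulate f , tabulate g′ , ∅) j others ⟩
    0ℚ ∎)
    where
    open ≡-Reasoning
    g′ = updateAt g j (const false)
    s = ∣ tabulate f ∣ + below (tabulate g′) j
    others : ∀ i → i ≢ j → ∂ξ i p (tabulate f , tabulate g′ , ∅) ≡ 0ℚ
    others i i≢j = ∂ξ-occupied p (tabulate f) g′ ∅ (trans (VFP.updateAt-minimal i j g i≢j) (all-ξ i))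

  ∂θ∂ξ-occupied : ∀ {f g} i → f i ∨ g i ≡ true → ∂θ i (∂ξ i p) (tabulate f , tabulate g , ∅) ≡ 0ℚ
  ∂θ∂ξ-occupied {f} {g} i fi∨gi with f i in fi
  ... | true = ∂θ-occupied (∂ξ i p) f (tabulate g) ∅ fi
  ... | false = begin
    ∂θ i (∂ξ i p) (tabulate f , tabulate g , ∅)
      ≡⟨ ∂θ-vacant (∂ξ i p) f (tabulate g) ∅ fi ⟩
    sgnPow s * ∂ξ i p (tabulate (updateAt f i (const true)) , tabulate g , ∅)
      ≡⟨ cong (sgnPow s *_) (∂ξ-occupied p (tabulate (updateAt f i (const true))) g ∅ fi∨gi) ⟩
    sgnPow s * 0ℚ
      ≡⟨ ℚP.*-zeroʳ (sgnPow s) ⟩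
    0ℚ ∎
    where
    open ≡-Reasoning
    s = below (tabulate f) i

  both-without-none⇒coeff≡0 : ∀ {f g} u → f u ≡ true → g u ≡ true →
                              (∀ i → i ≢ u → f i ∨ g i ≡ true) → coeff p f g ≡ 0ℚ
  both-without-none⇒coeff≡0 {f} {g} u fu gu others = sgnPow*≡0⇒≡0 s₂ (sgnPow*≡0⇒≡0 s₁ (begin
    sgnPow s₁ * (sgnPow s₂ * coeff p f g)
      ≡⟨ cong (λ c → sgnPow s₁ * (sgnPow s₂ * c)) restored ⟩
    sgnPow s₁ * (sgnPow s₂ * coeff p f″ g″)
      ≡⟨ cong (sgnPow s₁ *_) (sym (∂ξ-vacant p (tabulate f″) g′ ∅ (VFP.updateAt-updates u g))) ⟩
    sgnPow s₁ * ∂ξ u p (tabulate f″ , tabulate g′ , ∅)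
      ≡⟨ sym (∂θ-vacant (∂ξ u p) f′ _ ∅ (VFP.updateAt-updates u f)) ⟩
    ∂θ u (∂ξ u p) (tabulate f′ , tabulate g′ , ∅)
      ≡⟨ harmonic-single {true} {true} {false} refl (tabulate f′ , tabulate g′ , ∅) u others′ ⟩
    0ℚ ∎))
    where
    open ≡-Reasoning
    f′ = updateAt f u (const false)
    g′ = updateAt g u (const false)
    f″ = updateAt f′ u (const true)
    g″ = updateAt g′ u (const true)
    s₁ = below (tabulate f′) u
    s₂ = ∣ tabulate f″ ∣ + below (tabulate g′) u
    restored : coeff p f g ≡ coeff p f″ g″
    restored = coeff-cong p (sym ∘ updateAt-restore f u fu) (sym ∘ updateAt-restore g u gu)
    others′ : ∀ i → i ≢ u → ∂θ i (∂ξ i p) (tabulate f′ , tabulate g′ , ∅) ≡ 0ℚ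
    others′ i i≢u = ∂θ∂ξ-occupied i (subst₂ (λ x y → x ∨ y ≡ true)
      (sym (VFP.updateAt-minimal i u f i≢u)) (sym (VFP.updateAt-minimal i u g i≢u)) (others i i≢u))

-- Antisymmetry

module _ {n} {p : Poly n} (antisymmetric : Antisymmetric p) where

  act-coeff : ∀ σ f g →
    sgnPow (inv σ (tabulate (f ∘ (σ ⟨$⟩ʳ_))) + inv σ (tabulate (g ∘ (σ ⟨$⟩ʳ_))) + inv σ ∅)
      * coeff p (f ∘ (σ ⟨$⟩ʳ_)) (g ∘ (σ ⟨$⟩ʳ_))
    ≡ sgn σ * coeff p f g
  act-coeff σ f g = trans (cong signed (sym pre-M)) (antisymmetric σ (tabulate f , tabulate g , ∅))
    where
    signed : Mono n → ℚ
    signed (A , B , C) = sgnPow (inv σ A + inv σ B + inv σ C) * p (A , B , C)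
    pre-M : (pre σ (tabulate f) , pre σ (tabulate g) , pre σ ∅)
          ≡ (tabulate (f ∘ (σ ⟨$⟩ʳ_)) , tabulate (g ∘ (σ ⟨$⟩ʳ_)) , ∅)
    pre-M = cong₂ _,_ (pre-tabulate σ f) (cong₂ _,_ (pre-tabulate σ g) (pre-∅ σ))

  permuted≡0⇒coeff≡0 : ∀ σ {f g} → coeff p (f ∘ (σ ⟨$⟩ʳ_)) (g ∘ (σ ⟨$⟩ʳ_)) ≡ 0ℚ →
                       coeff p f g ≡ 0ℚ
  permuted≡0⇒coeff≡0 σ {f} {g} permuted≡0 = sgnPow*≡0⇒≡0 (inv σ (tabulate (λ _ → true))) (begin
    sgn σ * coeff p f g                                  ≡⟨ sym (act-coeff σ f g) ⟩
    sgnPow e * coeff p (f ∘ (σ ⟨$⟩ʳ_)) (g ∘ (σ ⟨$⟩ʳ_))  ≡⟨ cong (sgnPow e *_) permuted≡0 ⟩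
    sgnPow e * 0ℚ                                        ≡⟨ ℚP.*-zeroʳ (sgnPow e) ⟩
    0ℚ                                                   ∎)
    where
    open ≡-Reasoning
    e = inv σ (tabulate (f ∘ (σ ⟨$⟩ʳ_))) + inv σ (tabulate (g ∘ (σ ⟨$⟩ʳ_))) + inv σ ∅

  module _ {u v : Fin n} (u~v : Adjacent u v) where

    private
      τ = PC.transpose u v

    coeff-swap-adjacent : ∀ f g →
      sgnPow (iverson (f v ∧ f u) + iverson (g v ∧ g u)) * coeff p (f ∘ τ) (g ∘ τ) ≡ - coeff p f g
    coeff-swap-adjacent f g = begin
      sgnPow (iverson (f v ∧ f u) + iverson (g v ∧ g u)) * coeff p (f ∘ τ) (g ∘ τ)
        ≡⟨ cong (λ e → sgnPow e * coeff p (f ∘ τ) (g ∘ τ)) (sym exponent) ⟩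
      sgnPow (inv (transpose u v) (tabulate (f ∘ τ)) + inv (transpose u v) (tabulate (g ∘ τ))
              + inv (transpose u v) ∅) * coeff p (f ∘ τ) (g ∘ τ)
        ≡⟨ act-coeff (transpose u v) f g ⟩
      sgn (transpose u v) * coeff p f g
        ≡⟨ cong (λ e → sgnPow e * coeff p f g) (trans (inv-adjacent u~v full)
             (cong₂ (λ x y → iverson (x ∧ y)) (VP.lookup∘tabulate (λ _ → true) u)
                                              (VP.lookup∘tabulate (λ _ → true) v))) ⟩
      - 1ℚ * coeff p f g
        ≡⟨ -1*x≈-x (coeff p f g) ⟩
      - coeff p f g ∎
      where
      open ≡-Reasoning
      full : Subset n
      full = tabulate (λ _ → true)
      inv-tabulate : ∀ h → inv (transpose u v) (tabulate (h ∘ τ)) ≡ iverson (h v ∧ h u)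
      inv-tabulate h = trans (inv-adjacent u~v (tabulate (h ∘ τ))) (cong iverson (cong₂ _∧_
        (trans (VP.lookup∘tabulate (h ∘ τ) u) (cong h (transpose-matchˡ u v)))
        (trans (VP.lookup∘tabulate (h ∘ τ) v) (cong h (transpose-matchʳ u v)))))
      inv-∅ : inv (transpose u v) ∅ ≡ 0
      inv-∅ = trans (inv-adjacent u~v ∅)
        (cong₂ (λ x y → iverson (x ∧ y)) (VP.lookup-replicate u false) (VP.lookup-replicate v false))
      exponent : inv (transpose u v) (tabulate (f ∘ τ)) + inv (transpose u v) (tabulate (g ∘ τ))
                 + inv (transpose u v) ∅
                 ≡ iverson (f v ∧ f u) + iverson (g v ∧ g u)
      exponent = trans (cong₂ _+_ (cong₂ _+_ (inv-tabulate f) (inv-tabulate g)) inv-∅) (ℕP.+-identityʳ _)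

    coeff-swap-odd : ∀ {f g f′ g′} → f ∘ τ ≗ f′ → g ∘ τ ≗ g′ →
                     sgnPow (iverson (f v ∧ f u) + iverson (g v ∧ g u)) ≡ - 1ℚ → coeff p f′ g′ ≡ coeff p f g
    coeff-swap-odd {f} {g} {f′} {g′} f∘τ≗f′ g∘τ≗g′ odd = ℚP.neg-injective (begin
      - coeff p f′ g′
        ≡⟨ sym (-1*x≈-x _) ⟩
      - 1ℚ * coeff p f′ g′
        ≡⟨ cong₂ _*_ (sym odd) (coeff-cong p (sym ∘ f∘τ≗f′) (sym ∘ g∘τ≗g′)) ⟩
      sgnPow (iverson (f v ∧ f u) + iverson (g v ∧ g u)) * coeff p (f ∘ τ) (g ∘ τ)
        ≡⟨ coeff-swap-adjacent f g ⟩
      - coeff p f g ∎)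
      where open ≡-Reasoning

    coeff-swap-even : ∀ {f g f′ g′} → f ∘ τ ≗ f′ → g ∘ τ ≗ g′ →
                      sgnPow (iverson (f v ∧ f u) + iverson (g v ∧ g u)) ≡ 1ℚ → coeff p f′ g′ ≡ - coeff p f g
    coeff-swap-even {f} {g} {f′} {g′} f∘τ≗f′ g∘τ≗g′ even = begin
      coeff p f′ g′
        ≡⟨ sym (ℚP.*-identityˡ _) ⟩
      1ℚ * coeff p f′ g′
        ≡⟨ cong₂ _*_ (sym even) (coeff-cong p (sym ∘ f∘τ≗f′) (sym ∘ g∘τ≗g′)) ⟩
      sgnPow (iverson (f v ∧ f u) + iverson (g v ∧ g u)) * coeff p (f ∘ τ) (g ∘ τ)
        ≡⟨ coeff-swap-adjacent f g ⟩
      - coeff p f g ∎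
      where open ≡-Reasoning

    repeated-adjacent⇒coeff≡0 : ∀ b {f g} →
                                f u ≡ b → f v ≡ b → g u ≡ b → g v ≡ b → coeff p f g ≡ 0ℚ
    repeated-adjacent⇒coeff≡0 b {f} {g} fu fv gu gv =
      x≡-x⇒x≡0 (coeff-swap-even (∘transpose-≗ f (trans fu (sym fv)))
                                (∘transpose-≗ g (trans gu (sym gv))) even)
      where
      even : sgnPow (iverson (f v ∧ f u) + iverson (g v ∧ g u)) ≡ 1ℚ
      even rewrite fu | fv | gu | gv = sgnPow-repeated b

  repeated<⇒coeff≡0 : ∀ b {f g u w} → u < w →
                      f u ≡ b → g u ≡ b → f w ≡ b → g w ≡ b → coeff p f g ≡ 0ℚ
  repeated<⇒coeff≡0 b {f} {g} {u} {w} u<w fu gu fw gw =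
    permuted≡0⇒coeff≡0 (transpose v w)
      (repeated-adjacent⇒coeff≡0 u~v b (trans (cong f τu≡u) fu) (trans (cong f (transpose-matchˡ v w)) fw)
                                       (trans (cong g τu≡u) gu) (trans (cong g (transpose-matchˡ v w)) gw))
    where
    v = proj₁ (adjacent-successor u<w)
    u~v = proj₂ (adjacent-successor u<w)
    τu≡u : PC.transpose v w u ≡ u
    τu≡u = transpose-other (λ u≡v → ℕP.<-irrefl (cong toℕ u≡v) (adjacent⇒< u~v))
                           (λ u≡w → ℕP.<-irrefl (cong toℕ u≡w) u<w)

  repeated⇒coeff≡0 : ∀ b {f g u w} → u ≢ w →
                     f u ≡ b → g u ≡ b → f w ≡ b → g w ≡ b → coeff p f g ≡ 0ℚ
  repeated⇒coeff≡0 b {u = u} {w} u≢w fu gu fw gw with FinP.<-cmp u w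
  ... | tri< u<w _ _ = repeated<⇒coeff≡0 b u<w fu gu fw gw
  ... | tri≈ _ u≡w _ = ⊥-elim (u≢w u≡w)
  ... | tri> _ _ w<u = repeated<⇒coeff≡0 b w<u fw gw fu gu

  diagonal-unique : ∀ {f g} → coeff p f g ≢ 0ℚ →
                    ∀ b {i j} → (f i , g i) ≡ (b , b) → (f j , g j) ≡ (b , b) → i ≡ j
  diagonal-unique c≢0 b {i} {j} ti tj with i FinP.≟ j
  ... | yes i≡j = i≡j
  ... | no i≢j =
    ⊥-elim (c≢0 (repeated⇒coeff≡0 b i≢j (cong proj₁ ti) (cong proj₂ ti) (cong proj₁ tj) (cong proj₂ tj)))

-- Canonical monomials

pattern θ-only = (true , false)
pattern none   = (false , false)
pattern both   = (true , true)
pattern ξ-only = (false , true)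

coeffᵗ : ∀ {n} → Poly n → (Fin n → Bool × Bool) → ℚ
coeffᵗ p t = coeff p (proj₁ ∘ t) (proj₂ ∘ t)

-- A sorted type vector has the shape θ-only* none? both? ξ-only* (given the uniqueness of none
-- and both), which is what Canonical treats.
rank : Bool × Bool → ℕ
rank θ-only = 0
rank none   = 1
rank both   = 2
rank ξ-only = 3

rank≤1 : ∀ x → rank x ≤ 1 → x ≡ θ-only ⊎ x ≡ none
rank≤1 θ-only _ = inj₁ refl
rank≤1 none   _ = inj₂ refl
rank≤1 both   (s≤s ())
rank≤1 ξ-only (s≤s ())

rank≥2 : ∀ x → 2 ≤ rank x → x ≡ both ⊎ x ≡ ξ-only
rank≥2 θ-only ()
rank≥2 none   (s≤s ())
rank≥2 both   _ = inj₁ refl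
rank≥2 ξ-only _ = inj₂ refl

rank-1-2 : ∀ x → 1 ≤ rank x → rank x ≤ 2 → x ≡ none ⊎ x ≡ both
rank-1-2 θ-only () _
rank-1-2 none   _ _ = inj₁ refl
rank-1-2 both   _ _ = inj₂ refl
rank-1-2 ξ-only _ (s≤s (s≤s ()))

rank≥3 : ∀ x → 3 ≤ rank x → x ≡ ξ-only
rank≥3 θ-only ()
rank≥3 none   (s≤s ())
rank≥3 both   (s≤s (s≤s ()))
rank≥3 ξ-only _ = refl

-- For v = u + 1, a₀ is the coefficient of θ_{≤u} ξ_{>u}, G i that of θ_{<u} θ_i ξ_{>u} (i > u)
-- and H i that of θ_{≤u} ξ_i ξ_{>v} (i ≤ u).
module Canonical {n} {p : Poly n} (harmonic : InT p) (antisymmetric : Antisymmetric p)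
                 {u v : Fin n} (u~v : Adjacent u v) where

  upper lower lowerᵤ upperᵥ : Fin n → Bool
  upper i = toℕ u <ᵇ toℕ i
  lower i = not (upper i)
  lowerᵤ = updateAt lower u (const false)
  upperᵥ = updateAt upper v (const false)

  a₀ : ℚ
  a₀ = coeff p lower upper

  G H : Fin n → ℚ
  G i = coeff p (updateAt lowerᵤ i (const true)) upper
  H i = coeff p lower (updateAt upperᵥ i (const true))

  u<v : u < v
  u<v = adjacent⇒< u~v

  <v⇒≤u : ∀ {i : Fin n} → i < v → toℕ i ≤ toℕ u
  <v⇒≤u {i} i<v = ℕP.≤-pred (subst (toℕ i ℕ.<_) u~v i<v)

  upper-≤ : ∀ {i : Fin n} → toℕ i ≤ toℕ u → upper i ≡ false
  upper-≤ = ≤⇒<ᵇ≡false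

  upper-> : ∀ {i : Fin n} → u < i → upper i ≡ true
  upper-> = <⇒<ᵇ≡true

  lower-≤ : ∀ {i : Fin n} → toℕ i ≤ toℕ u → lower i ≡ true
  lower-≤ i≤u = cong not (upper-≤ i≤u)

  lower-> : ∀ {i : Fin n} → u < i → lower i ≡ false
  lower-> u<i = cong not (upper-> u<i)

  lowerᵤ-≥ : ∀ {i : Fin n} → toℕ u ≤ toℕ i → lowerᵤ i ≡ false
  lowerᵤ-≥ {i} u≤i with i FinP.≟ u
  ... | yes refl = VFP.updateAt-updates i lower
  ... | no i≢u = trans (VFP.updateAt-minimal i u lower i≢u) (lower-> (FinP.≤∧≢⇒< u≤i (i≢u ∘ sym)))

  lowerᵤ-< : ∀ {i : Fin n} → i < u → lowerᵤ i ≡ true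
  lowerᵤ-< {i} i<u = trans (VFP.updateAt-minimal i u lower (FinP.<⇒≢ i<u)) (lower-≤ (ℕP.<⇒≤ i<u))

  upperᵥ-≤ : ∀ {i : Fin n} → toℕ i ≤ toℕ v → upperᵥ i ≡ false
  upperᵥ-≤ {i} i≤v with i FinP.≟ v
  ... | yes refl = VFP.updateAt-updates i upper
  ... | no i≢v = trans (VFP.updateAt-minimal i v upper i≢v) (upper-≤ (<v⇒≤u (FinP.≤∧≢⇒< i≤v i≢v)))

  upperᵥ-> : ∀ {i : Fin n} → v < i → upperᵥ i ≡ true
  upperᵥ-> {i} v<i = trans (VFP.updateAt-minimal i v upper (FinP.<⇒≢ v<i ∘ sym)) (upper-> (ℕP.<-trans u<v v<i))

  data Position (i : Fin n) : Set where
    before : i < u → Position i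
    at-u   : i ≡ u → Position i
    at-v   : i ≡ v → Position i
    after  : v < i → Position i

  position : ∀ i → Position i
  position i with FinP.<-cmp i u
  ... | tri< i<u _ _ = before i<u
  ... | tri≈ _ i≡u _ = at-u i≡u
  ... | tri> _ _ u<i with FinP.<-cmp v i
  ...   | tri< v<i _ _ = after v<i
  ...   | tri≈ _ v≡i _ = at-v (sym v≡i)
  ...   | tri> _ _ i<v = ⊥-elim (nothing-between u~v u<i i<v)

  G-step : ∀ {i i′ : Fin n} → Adjacent i i′ → u < i → G i ≡ G i′
  G-step {i} {i′} i~i′ u<i = coeff-swap-odd antisymmetric i~i′
    (updateAt-∘transpose lowerᵤ true (trans (lowerᵤ-≥ (ℕP.<⇒≤ u<i)) (sym (lowerᵤ-≥ (ℕP.<⇒≤ u<i′)))))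
    (∘transpose-≗ upper (trans (upper-> u<i) (sym (upper-> u<i′))))
    (swap-sign-cong (VFP.updateAt-updates i′ lowerᵤ)
                    (trans (VFP.updateAt-minimal i i′ lowerᵤ (FinP.<⇒≢ i<i′)) (lowerᵤ-≥ (ℕP.<⇒≤ u<i)))
                    (upper-> u<i′) (upper-> u<i))
    where
    i<i′ = adjacent⇒< i~i′
    u<i′ = ℕP.<-trans u<i i<i′

  H-step : ∀ {i i′ : Fin n} → Adjacent i i′ → toℕ i′ ≤ toℕ u → H i ≡ H i′
  H-step {i} {i′} i~i′ i′≤u = coeff-swap-odd antisymmetric i~i′
    (∘transpose-≗ lower (trans (lower-≤ i≤u) (sym (lower-≤ i′≤u))))
    (updateAt-∘transpose upperᵥ true (trans (upperᵥ-≤ i≤v) (sym (upperᵥ-≤ i′≤v))))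
    (swap-sign-cong (lower-≤ i′≤u) (lower-≤ i≤u) (VFP.updateAt-updates i′ upperᵥ)
                    (trans (VFP.updateAt-minimal i i′ upperᵥ (FinP.<⇒≢ i<i′)) (upperᵥ-≤ i≤v)))
    where
    i<i′ = adjacent⇒< i~i′
    i≤u = ℕP.<⇒≤ (ℕP.<-≤-trans i<i′ i′≤u)
    i′≤v = ℕP.≤-trans i′≤u (ℕP.<⇒≤ u<v)
    i≤v = ℕP.≤-trans i≤u (ℕP.<⇒≤ u<v)

  G-const : ∀ {i : Fin n} → u < i → G v ≡ G i
  G-const u<i = adjacent-chain G (suc (toℕ u)) n (λ k~k′ u<k _ → G-step k~k′ u<k)
    (ℕP.≤-reflexive (sym u~v)) (ℕP.≤-trans (ℕP.≤-reflexive u~v) u<i) (ℕP.<⇒≤ (FinP.toℕ<n _))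

  H-const : ∀ {i : Fin n} → toℕ i ≤ toℕ u → H i ≡ H u
  H-const i≤u = adjacent-chain H 0 (toℕ u) (λ k~k′ _ k′≤u → H-step k~k′ k′≤u) z≤n i≤u ℕP.≤-refl

  G≡-H : G v ≡ - H u
  G≡-H = coeff-swap-even antisymmetric u~v lower∘τ g∘τ
    (swap-sign-cong (lower-> u<v) (lower-≤ ℕP.≤-refl)
                    (trans (VFP.updateAt-minimal v u upperᵥ v≢u) (VFP.updateAt-updates v upper))
                    (VFP.updateAt-updates u upperᵥ))
    where
    u≢v = FinP.<⇒≢ u<v
    v≢u = u≢v ∘ sym
    g = updateAt upperᵥ u (const true)
    lower∘τ : lower ∘ PC.transpose u v ≗ updateAt lowerᵤ v (const true)
    lower∘τ k with transposeView u v k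
    ... | at-i refl τk≡v = trans (cong lower τk≡v) (trans (lower-> u<v)
            (sym (trans (VFP.updateAt-minimal k v lowerᵤ u≢v) (VFP.updateAt-updates k lower))))
    ... | at-j _ refl τk≡u = trans (cong lower τk≡u) (trans (lower-≤ ℕP.≤-refl)
            (sym (VFP.updateAt-updates k lowerᵤ)))
    ... | other k≢u k≢v τk≡k = trans (cong lower τk≡k)
            (sym (trans (VFP.updateAt-minimal k v lowerᵤ k≢v) (VFP.updateAt-minimal k u lower k≢u)))
    g∘τ : g ∘ PC.transpose u v ≗ upper
    g∘τ k with transposeView u v k
    ... | at-i refl τk≡v = trans (cong g τk≡v) (trans (VFP.updateAt-minimal v k upperᵥ v≢u)
            (trans (VFP.updateAt-updates v upper) (sym (upper-≤ ℕP.≤-refl))))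
    ... | at-j _ refl τk≡u = trans (cong g τk≡u) (trans (VFP.updateAt-updates u upperᵥ)
            (sym (upper-> u<v)))
    ... | other k≢u k≢v τk≡k = trans (cong g τk≡k)
            (trans (VFP.updateAt-minimal k u upperᵥ k≢u) (VFP.updateAt-minimal k v upper k≢v))

  open ≡-Reasoning

  M₁ M₂ : Mono n
  M₁ = tabulate lowerᵤ , tabulate upper , ∅
  M₂ = tabulate lower , tabulate upperᵥ , ∅

  s₁ s₂ : ℕ
  s₁ = below (tabulate lowerᵤ) u
  s₂ = ∣ tabulate lower ∣ + below (tabulate upperᵥ) v

  above atOrBelow : Fin n → ℚ
  above i = if upper i then G v else 0ℚ
  atOrBelow i = if upper i then 0ℚ else - G v

  θ-terms : ∀ i → ∂θ i p M₁ ≡ sgnPow s₁ * (δ u a₀ i +ℚ above i)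
  θ-terms i with FinP.<-cmp i u
  ... | tri< i<u i≢u _ = begin
    ∂θ i p M₁                    ≡⟨ ∂θ-occupied p lowerᵤ (tabulate upper) ∅ (lowerᵤ-< i<u) ⟩
    0ℚ                           ≡⟨ sym (ℚP.*-zeroʳ (sgnPow s₁)) ⟩
    sgnPow s₁ * (0ℚ +ℚ 0ℚ)       ≡⟨ cong (sgnPow s₁ *_) (sym (cong₂ _+ℚ_ (δ-≢ i≢u)
                                      (cong (if_then G v else 0ℚ) (upper-≤ (ℕP.<⇒≤ i<u))))) ⟩
    sgnPow s₁ * (δ u a₀ i +ℚ above i) ∎
  ... | tri≈ _ refl _ = begin
    ∂θ i p M₁                    ≡⟨ ∂θ-vacant p lowerᵤ (tabulate upper) ∅ (lowerᵤ-≥ ℕP.≤-refl) ⟩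
    sgnPow s₁ * coeff p (updateAt lowerᵤ i (const true)) upper
                                 ≡⟨ cong (sgnPow s₁ *_) (coeff-cong p
                                      (updateAt-restore lower i (lower-≤ ℕP.≤-refl)) (λ _ → refl)) ⟩
    sgnPow s₁ * a₀               ≡⟨ cong (sgnPow s₁ *_) (sym (ℚP.+-identityʳ a₀)) ⟩
    sgnPow s₁ * (a₀ +ℚ 0ℚ)       ≡⟨ cong (sgnPow s₁ *_) (sym (cong₂ _+ℚ_ (δ-≡ {j = i})
                                      (cong (if_then G v else 0ℚ) (upper-≤ ℕP.≤-refl)))) ⟩
    sgnPow s₁ * (δ u a₀ i +ℚ above i) ∎
  ... | tri> _ i≢u u<i = begin
    ∂θ i p M₁                    ≡⟨ ∂θ-vacant p lowerᵤ (tabulate upper) ∅ (lowerᵤ-≥ (ℕP.<⇒≤ u<i)) ⟩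
    sgnPow (below (tabulate lowerᵤ) i) * G i
                                 ≡⟨ cong₂ (λ e c → sgnPow e * c) (sym below-u≡below-i) (sym (G-const u<i)) ⟩
    sgnPow s₁ * G v              ≡⟨ cong (sgnPow s₁ *_) (sym (ℚP.+-identityˡ (G v))) ⟩
    sgnPow s₁ * (0ℚ +ℚ G v)      ≡⟨ cong (sgnPow s₁ *_) (sym (cong₂ _+ℚ_ (δ-≢ i≢u)
                                      (cong (if_then G v else 0ℚ) (upper-> u<i)))) ⟩
    sgnPow s₁ * (δ u a₀ i +ℚ above i) ∎
    where
    below-u≡below-i : below (tabulate lowerᵤ) u ≡ below (tabulate lowerᵤ) i
    below-u≡below-i = below-stable (tabulate lowerᵤ) (ℕP.<⇒≤ u<i)
      (λ a u≤a _ → trans (VP.lookup∘tabulate lowerᵤ a) (lowerᵤ-≥ u≤a))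

  ξ-terms : ∀ i → ∂ξ i p M₂ ≡ sgnPow s₂ * (δ v a₀ i +ℚ atOrBelow i)
  ξ-terms i with FinP.<-cmp i v
  ... | tri< i<v i≢v _ = begin
    ∂ξ i p M₂                    ≡⟨ ∂ξ-vacant p (tabulate lower) upperᵥ ∅ (upperᵥ-≤ (ℕP.<⇒≤ i<v)) ⟩
    sgnPow (∣ tabulate lower ∣ + below (tabulate upperᵥ) i) * H i
                                 ≡⟨ cong₂ (λ e c → sgnPow (∣ tabulate lower ∣ + e) * c)
                                          below-i≡below-v (H-const (<v⇒≤u i<v)) ⟩
    sgnPow s₂ * H u              ≡⟨ cong (sgnPow s₂ *_) H≡-G ⟩
    sgnPow s₂ * - G v            ≡⟨ cong (sgnPow s₂ *_) (sym (ℚP.+-identityˡ (- G v))) ⟩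
    sgnPow s₂ * (0ℚ +ℚ - G v)    ≡⟨ cong (sgnPow s₂ *_) (sym (cong₂ _+ℚ_ (δ-≢ i≢v)
                                      (cong (if_then 0ℚ else - G v) (upper-≤ (<v⇒≤u i<v))))) ⟩
    sgnPow s₂ * (δ v a₀ i +ℚ atOrBelow i) ∎
    where
    below-i≡below-v : below (tabulate upperᵥ) i ≡ below (tabulate upperᵥ) v
    below-i≡below-v = below-stable (tabulate upperᵥ) (ℕP.<⇒≤ i<v)
      (λ a _ a<v → trans (VP.lookup∘tabulate upperᵥ a) (upperᵥ-≤ (ℕP.<⇒≤ a<v)))
    H≡-G : H u ≡ - G v
    H≡-G = trans (sym (solve 1 (λ x → :- (:- x) := x) refl (H u))) (cong -_ (sym G≡-H))
  ... | tri≈ _ refl _ = begin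
    ∂ξ i p M₂                    ≡⟨ ∂ξ-vacant p (tabulate lower) upperᵥ ∅ (upperᵥ-≤ ℕP.≤-refl) ⟩
    sgnPow s₂ * coeff p lower (updateAt upperᵥ i (const true))
                                 ≡⟨ cong (sgnPow s₂ *_) (coeff-cong p (λ _ → refl)
                                      (updateAt-restore upper i (upper-> u<v))) ⟩
    sgnPow s₂ * a₀               ≡⟨ cong (sgnPow s₂ *_) (sym (ℚP.+-identityʳ a₀)) ⟩
    sgnPow s₂ * (a₀ +ℚ 0ℚ)       ≡⟨ cong (sgnPow s₂ *_) (sym (cong₂ _+ℚ_ (δ-≡ {j = i})
                                      (cong (if_then 0ℚ else - G v) (upper-> u<v)))) ⟩
    sgnPow s₂ * (δ v a₀ i +ℚ atOrBelow i) ∎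
  ... | tri> _ i≢v v<i = begin
    ∂ξ i p M₂                    ≡⟨ ∂ξ-occupied p (tabulate lower) upperᵥ ∅ (upperᵥ-> v<i) ⟩
    0ℚ                           ≡⟨ sym (ℚP.*-zeroʳ (sgnPow s₂)) ⟩
    sgnPow s₂ * (0ℚ +ℚ 0ℚ)       ≡⟨ cong (sgnPow s₂ *_) (sym (cong₂ _+ℚ_ (δ-≢ i≢v)
                                      (cong (if_then 0ℚ else - G v) (upper-> (ℕP.<-trans u<v v<i))))) ⟩
    sgnPow s₂ * (δ v a₀ i +ℚ atOrBelow i) ∎

  θ-equation : a₀ +ℚ ℚΣ.sum above ≡ 0ℚ
  θ-equation = harmonic⇒x+sum≡0 harmonic {true} {false} {false} refl M₁ s₁ u a₀ above θ-terms

  ξ-equation : a₀ +ℚ ℚΣ.sum atOrBelow ≡ 0ℚ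
  ξ-equation = harmonic⇒x+sum≡0 harmonic {false} {true} {false} refl M₂ s₂ v a₀ atOrBelow ξ-terms

  -- above i − atOrBelow i = G v for every i, so the two equations subtract to n · G v = 0.
  G≡0 : G v ≡ 0ℚ
  G≡0 = sum-const≡0⇒≡0 u (G v) (begin
    ℚΣ.sum {n} (λ _ → G v)
      ≡⟨ ℚΣ.sum-cong-≗ {n} (λ i → sym (split (upper i))) ⟩
    ℚΣ.sum (λ i → above i +ℚ - atOrBelow i)
      ≡⟨ ℚΣ.∑-distrib-+ above (λ i → - atOrBelow i) ⟩
    ℚΣ.sum above +ℚ ℚΣ.sum (λ i → - atOrBelow i)
      ≡⟨ cong (ℚΣ.sum above +ℚ_) (sum-neg atOrBelow) ⟩
    ℚΣ.sum above +ℚ - ℚΣ.sum atOrBelow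
      ≡⟨ solve 3 (λ a x y → x :+ (:- y) := (a :+ x) :+ (:- (a :+ y))) refl
                 a₀ (ℚΣ.sum above) (ℚΣ.sum atOrBelow) ⟩
    (a₀ +ℚ ℚΣ.sum above) +ℚ - (a₀ +ℚ ℚΣ.sum atOrBelow)
      ≡⟨ cong₂ (λ x y → x +ℚ - y) θ-equation ξ-equation ⟩
    0ℚ ∎)
    where
    split : ∀ b → (if b then G v else 0ℚ) +ℚ - (if b then 0ℚ else - G v) ≡ G v
    split true = ℚP.+-identityʳ (G v)
    split false = trans (ℚP.+-identityˡ _) (solve 1 (λ x → :- (:- x) := x) refl (G v))

  a₀≡0 : a₀ ≡ 0ℚ
  a₀≡0 = begin
    a₀                  ≡⟨ sym (ℚP.+-identityʳ a₀) ⟩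
    a₀ +ℚ 0ℚ            ≡⟨ cong (a₀ +ℚ_) (sym (sum-zero ℚP.+-0-commutativeMonoid above (above≡0 ∘ upper))) ⟩
    a₀ +ℚ ℚΣ.sum above  ≡⟨ θ-equation ⟩
    0ℚ                  ∎
    where
    above≡0 : ∀ b → (if b then G v else 0ℚ) ≡ 0ℚ
    above≡0 true = G≡0
    above≡0 false = refl

  coeff-mixed-shape≡0 : ∀ {t} → (∀ i → toℕ i ≤ toℕ u → t i ≡ θ-only) →
                        (∀ i → u < i → t i ≡ ξ-only) → coeffᵗ p t ≡ 0ℚ
  coeff-mixed-shape≡0 {t} left right = trans (coeff-cong p (cong proj₁ ∘ shape) (cong proj₂ ∘ shape)) a₀≡0
    where
    at-or-below : ∀ {i} → toℕ i ≤ toℕ u → t i ≡ (lower i , upper i)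
    at-or-below {i} i≤u = trans (left i i≤u) (sym (cong₂ _,_ (lower-≤ i≤u) (upper-≤ i≤u)))
    above-u : ∀ {i} → u < i → t i ≡ (lower i , upper i)
    above-u {i} u<i = trans (right i u<i) (sym (cong₂ _,_ (lower-> u<i) (upper-> u<i)))
    shape : ∀ i → t i ≡ (lower i , upper i)
    shape i with position i
    ... | before i<u = at-or-below (ℕP.<⇒≤ i<u)
    ... | at-u refl  = at-or-below ℕP.≤-refl
    ... | at-v refl  = above-u u<v
    ... | after v<i  = above-u (ℕP.<-trans u<v v<i)

  coeff-none-both-shape≡0 : ∀ {t} → (∀ i → i < u → t i ≡ θ-only) → t u ≡ none → t v ≡ both →
                            (∀ i → v < i → t i ≡ ξ-only) → coeffᵗ p t ≡ 0ℚ
  coeff-none-both-shape≡0 {t} left tu tv right =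
    trans (coeff-cong p (cong proj₁ ∘ shape) (cong proj₂ ∘ shape)) G≡0
    where
    shape : ∀ i → t i ≡ (updateAt lowerᵤ v (const true) i , upper i)
    shape i with position i
    ... | before i<u = trans (left i i<u) (sym (cong₂ _,_
            (trans (VFP.updateAt-minimal i v lowerᵤ (FinP.<⇒≢ (ℕP.<-trans i<u u<v))) (lowerᵤ-< i<u))
            (upper-≤ (ℕP.<⇒≤ i<u))))
    ... | at-u refl = trans tu (sym (cong₂ _,_
            (trans (VFP.updateAt-minimal i v lowerᵤ (FinP.<⇒≢ u<v)) (lowerᵤ-≥ ℕP.≤-refl))
            (upper-≤ ℕP.≤-refl)))
    ... | at-v refl = trans tv (sym (cong₂ _,_ (VFP.updateAt-updates i lowerᵤ) (upper-> u<v)))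
    ... | after v<i = trans (right i v<i) (sym (cong₂ _,_
            (trans (VFP.updateAt-minimal i v lowerᵤ (FinP.<⇒≢ v<i ∘ sym))
                   (lowerᵤ-≥ (ℕP.<⇒≤ (ℕP.<-trans u<v v<i))))
            (upper-> (ℕP.<-trans u<v v<i))))

module _ {n} {p : Poly n} (harmonic : InT p) (antisymmetric : Antisymmetric p) where
  open Sorting rank

  coeff≡0-by-sorting : (Q : (Fin n → Bool × Bool) → Set) →
    (∀ {t t′} → t ≗ t′ → Q t → Q t′) → (∀ {t} i j → Q t → Q (t ∘ PC.transpose i j)) →
    (∀ t → Sorted t → Q t → coeffᵗ p t ≢ 0ℚ → ⊥) → ∀ t → Q t → coeffᵗ p t ≡ 0ℚ
  coeff≡0-by-sorting Q resp swap sorted-case t Qt with coeffᵗ p t ℚ.≟ 0ℚ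
  ... | yes c≡0 = c≡0
  ... | no c≢0 =
    let (t′ , (c′≢0 , Qt′) , sorted) = sorted-witness P resp′ swap′ (c≢0 , Qt)
    in ⊥-elim (sorted-case t′ sorted Qt′ c′≢0)
    where
    P : (Fin n → Bool × Bool) → Set
    P t = coeffᵗ p t ≢ 0ℚ × Q t
    resp′ : ∀ {t t′} → t ≗ t′ → P t → P t′
    resp′ t≗t′ (c≢0 , Qt) =
        (λ c′≡0 → c≢0 (trans (coeff-cong p (cong proj₁ ∘ t≗t′) (cong proj₂ ∘ t≗t′)) c′≡0))
      , resp t≗t′ Qt
    swap′ : ∀ {t} i j → P t → P (t ∘ PC.transpose i j)
    swap′ i j (c≢0 , Qt) = (c≢0 ∘ permuted≡0⇒coeff≡0 antisymmetric (transpose i j)) , swap i j Qt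

  Mixed : (Fin n → Bool × Bool) → Set
  Mixed t = ∀ i → proj₁ (t i) ≡ not (proj₂ (t i))

  sorted-mixed≡0 : Fin n → ∀ t → Sorted t → Mixed t → coeffᵗ p t ≡ 0ℚ
  sorted-mixed≡0 j t sorted mixed with monotone⇒threshold (proj₂ ∘ t) ξ-upward
    where
    ξ-upward : ∀ i i′ → toℕ i ≤ toℕ i′ → proj₂ (t i) ≡ true → proj₂ (t i′) ≡ true
    ξ-upward i i′ i≤i′ ξ∈ti = cong proj₂ (rank≥3 (t i′) (ℕP.≤-trans
      (ℕP.≤-reflexive (cong rank (sym (cong₂ _,_ (trans (mixed i) (cong not ξ∈ti)) ξ∈ti))))
      (sorted i i′ i≤i′)))
  ... | zero , threshold = all-ξ⇒coeff≡0 harmonic j threshold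
  ... | suc k , threshold with n ℕ.≤? suc k
  ...   | yes n≤1+k = all-θ⇒coeff≡0 harmonic j θ-everywhere
    where
    θ-everywhere : ∀ i → proj₁ (t i) ≡ true
    θ-everywhere i = trans (mixed i) (cong not (trans (threshold i)
      (cong not (<⇒<ᵇ≡true (ℕP.<-≤-trans (FinP.toℕ<n i) n≤1+k)))))
  ...   | no n≰1+k = Canonical.coeff-mixed-shape≡0 harmonic antisymmetric u~v
      (λ i i≤u → θ-only-at i (trans (threshold i)
                   (cong not (<⇒<ᵇ≡true (s≤s (subst (toℕ i ≤_) toℕ-u i≤u))))))
      (λ i u<i → ξ-only-at i (trans (threshold i)
                   (cong not (≤⇒<ᵇ≡false (subst (ℕ._< toℕ i) toℕ-u u<i)))))
    where
    1+k<n = ℕP.≰⇒> n≰1+k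
    k<n = ℕP.<-trans (ℕP.n<1+n k) 1+k<n
    u = fromℕ< k<n
    v = fromℕ< 1+k<n
    toℕ-u : toℕ u ≡ k
    toℕ-u = FinP.toℕ-fromℕ< k<n
    u~v : Adjacent u v
    u~v = trans (FinP.toℕ-fromℕ< 1+k<n) (cong suc (sym toℕ-u))
    θ-only-at : ∀ i → proj₂ (t i) ≡ false → t i ≡ θ-only
    θ-only-at i ξ∉ti = cong₂ _,_ (trans (mixed i) (cong not ξ∉ti)) ξ∉ti
    ξ-only-at : ∀ i → proj₂ (t i) ≡ true → t i ≡ ξ-only
    ξ-only-at i ξ∈ti = cong₂ _,_ (trans (mixed i) (cong not ξ∈ti)) ξ∈ti

  mixed⇒coeff≡0 : Fin n → ∀ t → Mixed t → coeffᵗ p t ≡ 0ℚ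
  mixed⇒coeff≡0 j = coeff≡0-by-sorting Mixed
    (λ t≗t′ mixed i → subst (λ x → proj₁ x ≡ not (proj₂ x)) (t≗t′ i) (mixed i))
    (λ i j mixed → mixed ∘ PC.transpose i j)
    (λ t sorted mixed c≢0 → c≢0 (sorted-mixed≡0 j t sorted mixed))

  NoneAndBoth : (Fin n → Bool × Bool) → Set
  NoneAndBoth t = (∃[ i ] t i ≡ none) × (∃[ i ] t i ≡ both)

  sorted-none-both : ∀ t → Sorted t → NoneAndBoth t → coeffᵗ p t ≢ 0ℚ → ⊥
  sorted-none-both t sorted ((u , tu) , (v , tv)) c≢0 =
    c≢0 (Canonical.coeff-none-both-shape≡0 harmonic antisymmetric u~v before tu tv after)
    where
    unique : ∀ b {i j} → t i ≡ (b , b) → t j ≡ (b , b) → i ≡ j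
    unique = diagonal-unique antisymmetric c≢0
    rank≤ : ∀ {i j} → toℕ i ≤ toℕ j → ∀ {x y} → t i ≡ x → t j ≡ y → rank x ≤ rank y
    rank≤ i≤j refl refl = sorted _ _ i≤j
    u<v : u < v
    u<v = ℕP.≰⇒> (λ v≤u → ℕP.<-irrefl refl (ℕP.≤-trans (rank≤ v≤u tv tu) (s≤s z≤n)))
    w = proj₁ (adjacent-successor u<v)
    u~w = proj₂ (adjacent-successor u<v)
    w≡v : w ≡ v
    w≡v with rank-1-2 (t w) (rank≤ (ℕP.<⇒≤ (adjacent⇒< u~w)) tu refl)
                             (rank≤ (ℕP.≤-trans (ℕP.≤-reflexive u~w) u<v) refl tv)
    ... | inj₁ tw = ⊥-elim (FinP.<⇒≢ (adjacent⇒< u~w) (unique false tu tw))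
    ... | inj₂ tw = unique true tw tv
    u~v : Adjacent u v
    u~v = subst (Adjacent u) w≡v u~w
    before : ∀ i → i < u → t i ≡ θ-only
    before i i<u with rank≤1 (t i) (rank≤ (ℕP.<⇒≤ i<u) refl tu)
    ... | inj₁ ti = ti
    ... | inj₂ ti = ⊥-elim (FinP.<⇒≢ i<u (unique false ti tu))
    after : ∀ i → v < i → t i ≡ ξ-only
    after i v<i with rank≥2 (t i) (rank≤ (ℕP.<⇒≤ v<i) tv refl)
    ... | inj₁ ti = ⊥-elim (FinP.<⇒≢ v<i (unique true tv ti))
    ... | inj₂ ti = ti

  none-and-both⇒coeff≡0 : ∀ t → NoneAndBoth t → coeffᵗ p t ≡ 0ℚ
  none-and-both⇒coeff≡0 = coeff≡0-by-sorting NoneAndBoth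
    (λ { t≗t′ ((u , tu) , (v , tv)) → (u , trans (sym (t≗t′ u)) tu) , (v , trans (sym (t≗t′ v)) tv) })
    (λ { {t} i j ((u , tu) , (v , tv)) →
           (PC.transpose j i u , trans (cong t (PC.transpose-inverse i j)) tu)
         , (PC.transpose j i v , trans (cong t (PC.transpose-inverse i j)) tv) })
    sorted-none-both

-- Degree bounds

weight : ∀ {n} → (Fin n → Bool) → (Fin n → Bool) → Fin n → ℕ
weight f g i = iverson (f i) + iverson (g i)

weight≡0 : ∀ {a b} → iverson a + iverson b ≡ 0 → (a , b) ≡ none
weight≡0 {false} {false} _ = refl

weight≤1 : ∀ x → x ≢ both → iverson (proj₁ x) + iverson (proj₂ x) ≤ 1
weight≤1 θ-only _ = ℕP.≤-refl
weight≤1 none   _ = z≤n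
weight≤1 both   x≢both = ⊥-elim (x≢both refl)
weight≤1 ξ-only _ = ℕP.≤-refl

≢none⇒∨ : ∀ x → x ≢ none → proj₁ x ∨ proj₂ x ≡ true
≢none⇒∨ θ-only _ = refl
≢none⇒∨ none   x≢none = ⊥-elim (x≢none refl)
≢none⇒∨ both   _ = refl
≢none⇒∨ ξ-only _ = refl

≢none,both⇒mixed : ∀ x → x ≢ none → x ≢ both → proj₁ x ≡ not (proj₂ x)
≢none,both⇒mixed θ-only _ _ = refl
≢none,both⇒mixed none   x≢none _ = ⊥-elim (x≢none refl)
≢none,both⇒mixed both   _ x≢both = ⊥-elim (x≢both refl)
≢none,both⇒mixed ξ-only _ _ = refl

_≟ᵗ_ : (x y : Bool × Bool) → Dec (x ≡ y)
_≟ᵗ_ = ×P.≡-dec BoolP._≟_ BoolP._≟_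

n∸1≤degree : ∀ {n} {p : Poly n} → Antisymmetric p →
             ∀ {f g} → coeff p f g ≢ 0ℚ → n ∸ 1 ≤ ℕΣ.sum (weight f g)
n∸1≤degree antisymmetric c≢0 =
  n∸1≤sum _ (λ i j wi≡0 wj≡0 → diagonal-unique antisymmetric c≢0 false (weight≡0 wi≡0) (weight≡0 wj≡0))

degree≤n∸1 : ∀ {n} {p : Poly n} → InT p → Antisymmetric p →
             ∀ {f g} → coeff p f g ≢ 0ℚ → ℕΣ.sum (weight f g) ≤ n ∸ 1
degree≤n∸1 {zero} _ _ _ = z≤n
degree≤n∸1 {suc n} harmonic antisymmetric {f} {g} c≢0
  with FinP.any? (λ i → (f i , g i) ≟ᵗ none) | FinP.any? (λ i → (f i , g i) ≟ᵗ both)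
... | yes (v , tv) | no no-both =
  sum≤n∸1 (weight f g) (λ i → weight≤1 _ (no-both ∘ (i ,_))) v
          (cong (λ x → iverson (proj₁ x) + iverson (proj₂ x)) tv)
... | yes none-at | yes both-at =
  ⊥-elim (c≢0 (none-and-both⇒coeff≡0 harmonic antisymmetric _ (none-at , both-at)))
... | no no-none | yes (u , tu) =
  ⊥-elim (c≢0 (both-without-none⇒coeff≡0 harmonic {f} {g} u (cong proj₁ tu) (cong proj₂ tu)
                                           (λ i _ → ≢none⇒∨ _ (no-none ∘ (i ,_)))))
... | no no-none | no no-both =
  ⊥-elim (c≢0 (mixed⇒coeff≡0 harmonic antisymmetric fzero _
                              (λ i → ≢none,both⇒mixed _ (no-none ∘ (i ,_)) (no-both ∘ (i ,_)))))

monomial-coeff : ∀ {n} (p : Poly n) → InΘΞ p → ∀ A B C → p (A , B , C) ≢ 0ℚ →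
                 p (A , B , C) ≡ coeff p (lookup A) (lookup B)
                 × deg (A , B , C) ≡ ℕΣ.sum (weight (lookup A) (lookup B))
monomial-coeff {n} p ρ-free A B C pM≢0 with ρ-free A B C pM≢0
... | refl = cong₂ (λ A′ B′ → p (A′ , B′ , ∅)) (sym (VP.tabulate∘lookup A)) (sym (VP.tabulate∘lookup B))
           , (begin
  ∣ A ∣ + ∣ B ∣ + ∣ ∅ {n} ∣
    ≡⟨ cong₂ _+_ (cong₂ _+_ (∣∣≡sum A) (∣∣≡sum B)) (SubsetP.∣⊥∣≡0 n) ⟩
  ℕΣ.sum (iverson ∘ lookup A) + ℕΣ.sum (iverson ∘ lookup B) + 0
    ≡⟨ ℕP.+-identityʳ _ ⟩
  ℕΣ.sum (iverson ∘ lookup A) + ℕΣ.sum (iverson ∘ lookup B)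
    ≡⟨ sym (ℕΣ.∑-distrib-+ (iverson ∘ lookup A) (iverson ∘ lookup B)) ⟩
  ℕΣ.sum (weight (lookup A) (lookup B)) ∎)
  where open ≡-Reasoning

has-degree-n∸1 : ∀ {n} (p : Poly n) → InT p → InΘΞ p → Antisymmetric p → Nonzero p → HasDegree p (n ∸ 1)
has-degree-n∸1 {n} p harmonic ρ-free antisymmetric (M , pM≢0) =
  (M , pM≢0 , ℕP.≤-antisym (upper M pM≢0) (lower M pM≢0)) , upper
  where
  upper : ∀ M → p M ≢ 0ℚ → deg M ≤ n ∸ 1
  upper (A , B , C) pM≢0 with monomial-coeff p ρ-free A B C pM≢0
  ... | pM≡c , deg≡ = subst (_≤ n ∸ 1) (sym deg≡) (degree≤n∸1 harmonic antisymmetric (pM≢0 ∘ trans pM≡c))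
  lower : ∀ M → p M ≢ 0ℚ → n ∸ 1 ≤ deg M
  lower (A , B , C) pM≢0 with monomial-coeff p ρ-free A B C pM≢0
  ... | pM≡c , deg≡ = subst (n ∸ 1 ≤_) (sym deg≡) (n∸1≤degree antisymmetric (pM≢0 ∘ trans pM≡c))

corollary2p4 : (∀ (n : ℕ) (p : Poly n) → InT p → InΘ p → Antisymmetric p → Nonzero p →
                  HasDegree p (n ∸ 1))
               × (∀ (n : ℕ) (p : Poly n) → InT p → InΘΞ p → Antisymmetric p → Nonzero p →
                  HasDegree p (n ∸ 1))
corollary2p4 = (λ n p harmonic p∈Θ → has-degree-n∸1 p harmonic (λ A B C → proj₂ ∘ p∈Θ A B C))
             , (λ n p → has-degree-n∸1 p)
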